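{- Let $\mathcal{C}$ be a family of finite structures. If $\mathcal{C}$ has $LFP$-sOP, then $\mathcal{C}$ also has $LFP$-IP and $LFP$-TP2.
   Context: Least fixed-point ($LFP$) logic extends first-order logic by relation variables and the rule: if $\varphi$ is a formula in which an $n$-ary relation variable $S$ occurs only positively, $x$ an $n$-tuple of free variables and $u$ a fresh $n$-tuple, then $[\mathbf{lfp}\,Sx.\varphi](u)$ is a formula (binding $S,x$), which holds in a structure iff $u$ belongs to the least fixed point of the monotone operator $X\mapsto\{b:\varphi(b;X)\}$ (the union of the stages $I^\xi=\Gamma(\bigcup_{\eta<\xi}I^\eta)$). An $LFP$ formula has all relation variables bound. For a partitioned formula $\varphi(x;y)$ and a structure $\mathbf{M}$, with $\varphi(M^x;b)=\{a\in M^x:\mathbf{M}\models\varphi(a;b)\}$: - sOP($n$): there are $b_1,\dots,b_n\in M^y$ with $\varphi(M^x;b_1)\subsetneq\dots\subsetneq\varphi(M^x;b_n)$. - IP($n$): there are $a_1,\dots,a_n\in M^x$ and $b_1,\dots,b_{2^n}\in M^y$ with $\mathbf{M}\models\varphi(a_i;b_j)\iff i\in j$, identifying $\{1,\dots,2^n\}$ with the powerset of $\{1,\dots,n\}$. - TP2($n$): there are $b_{i,j}\in M^y$ ($1\le i,j\le n$) such that for each $i$ and distinct $j,k$ no $a\in M^x$ satisfies both $\varphi(a;b_{i,j})$ and $\varphi(a;b_{i,k})$, yet for every function $f:\{1,\dots,n\}\to\{1,\dots,n\}$ there is $a_f\in M^x$ with $\mathbf{M}\models\bigwedge_{i=1}^n\varphi(a_f;b_{i,f(i)})$.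 For $P$ among these, $\mathcal{C}$ has $LFP$-$P$ if some $LFP$ formula $\varphi(x;y)$ is such that for every $n<\omega$ there is $\mathbf{M}\in\mathcal{C}$ in which $\varphi$ has $P(n)$. -}

module Defs where

open import Data.Nat using (ℕ; zero; suc; _+_; _^_)
open import Data.Bool using (Bool; true; false; _∧_; _∨_; not; T)
open import Data.Fin using (Fin; zero; suc)
open import Data.Fin.Properties using (_≟_)
open import Data.Fin.Subset using (Subset; _∈_)
open import Data.Vec using (Vec; []; _∷_; lookup; map; _++_)
open import Data.List using (List; []; _∷_; length)
import Data.List as List
open import Data.List.Relation.Unary.Linked using (Linked)
open import Data.Product using (Σ; _×_; ∃; _,_)
open import Relation.Nullary using (¬_)
open import Relation.Nullary.Decidable using (⌊_⌋)
open import Relation.Binary.PropositionalEquality using (_≡_; _≢_)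
open import Function.Bundles using (_⇔_)

record Signature : Set where
  field
    nrel  : ℕ
    arity : Fin nrel → ℕ
open Signature public

record Structure (σ : Signature) : Set where
  field
    size : ℕ
    relOf : (r : Fin (nrel σ)) → Vec (Fin size) (arity σ r) → Bool
open Structure public

-- Syntax of LFP logic (de Bruijn).
-- Formula σ m Δ : m first-order variables in scope (Fin m),
-- Δ = list of arities of the relation variables in scope.

RVar : List ℕ → Set
RVar Δ = Fin (length Δ)

data Formula (σ : Signature) : ℕ → List ℕ → Set where
  eq   : ∀ {m Δ} → Fin m → Fin m → Formula σ m Δ
  rel  : ∀ {m Δ} (r : Fin (nrel σ)) → Vec (Fin m) (arity σ r) → Formula σ m Δ
  rvar : ∀ {m Δ} (i : RVar Δ) → Vec (Fin m) (List.lookup Δ i) → Formula σ m Δ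
  neg  : ∀ {m Δ} → Formula σ m Δ → Formula σ m Δ
  and  : ∀ {m Δ} → Formula σ m Δ → Formula σ m Δ → Formula σ m Δ
  -- ∃ binds the new variable zero
  ex   : ∀ {m Δ} → Formula σ (suc m) Δ → Formula σ m Δ
  -- [lfp S x. φ](u): S is the new relation variable zero (arity k),
  -- x are the new first-order variables 0..k-1 (the rest of the scope
  -- are parameters), u a k-tuple of variables of the outer scope.
  lfp  : ∀ {m Δ} k → Formula σ (k + m) (k ∷ Δ) → Vec (Fin m) k → Formula σ m Δ

mutual
  data Pos {σ : Signature} : ∀ {m Δ} → RVar Δ → Formula σ m Δ → Set where
    p-eq   : ∀ {m Δ i x y} → Pos {m = m} {Δ} i (eq x y)
    p-rel  : ∀ {m Δ i r ts} → Pos {m = m} {Δ} i (rel r ts)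
    p-rvar : ∀ {m Δ i j ts} → Pos {m = m} {Δ} i (rvar j ts)
    p-neg  : ∀ {m Δ i φ} → Neg {m = m} {Δ} i φ → Pos i (neg φ)
    p-and  : ∀ {m Δ i φ ψ} → Pos {m = m} {Δ} i φ → Pos i ψ → Pos i (and φ ψ)
    p-ex   : ∀ {m Δ i φ} → Pos {m = suc m} {Δ} i φ → Pos i (ex φ)
    p-lfp  : ∀ {m Δ i k φ us} → Pos {m = k + m} {k ∷ Δ} (suc i) φ → Pos {m = m} i (lfp k φ us)

  data Neg {σ : Signature} : ∀ {m Δ} → RVar Δ → Formula σ m Δ → Set where
    n-eq   : ∀ {m Δ i x y} → Neg {m = m} {Δ} i (eq x y)
    n-rel  : ∀ {m Δ i r ts} → Neg {m = m} {Δ} i (rel r ts)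
    n-rvar : ∀ {m Δ i j ts} → i ≢ j → Neg {m = m} {Δ} i (rvar j ts)
    n-neg  : ∀ {m Δ i φ} → Pos {m = m} {Δ} i φ → Neg i (neg φ)
    n-and  : ∀ {m Δ i φ ψ} → Neg {m = m} {Δ} i φ → Neg i ψ → Neg i (and φ ψ)
    n-ex   : ∀ {m Δ i φ} → Neg {m = suc m} {Δ} i φ → Neg i (ex φ)
    n-lfp  : ∀ {m Δ i k φ us} → Neg {m = k + m} {k ∷ Δ} (suc i) φ → Neg {m = m} i (lfp k φ us)

data WF {σ : Signature} : ∀ {m Δ} → Formula σ m Δ → Set where
  w-eq   : ∀ {m Δ x y} → WF {m = m} {Δ} (eq x y)
  w-rel  : ∀ {m Δ r ts} → WF {m = m} {Δ} (rel r ts)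
  w-rvar : ∀ {m Δ j ts} → WF {m = m} {Δ} (rvar j ts)
  w-neg  : ∀ {m Δ φ} → WF {m = m} {Δ} φ → WF (neg φ)
  w-and  : ∀ {m Δ φ ψ} → WF {m = m} {Δ} φ → WF ψ → WF (and φ ψ)
  w-ex   : ∀ {m Δ φ} → WF {m = suc m} {Δ} φ → WF (ex φ)
  w-lfp  : ∀ {m Δ k φ us} → Pos {m = k + m} {k ∷ Δ} zero φ → WF φ → WF {m = m} (lfp k φ us)

Env : List ℕ → ℕ → Set
Env Δ n = (i : RVar Δ) → Vec (Fin n) (List.lookup Δ i) → Bool

envCons : ∀ {Δ n k} → (Vec (Fin n) k → Bool) → Env Δ n → Env (k ∷ Δ) n
envCons X ε zero    = X
envCons X ε (suc i) = ε i

anyFin : ∀ {n} → (Fin n → Bool) → Bool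
anyFin {zero}  f = false
anyFin {suc n} f = f zero ∨ anyFin (λ i → f (suc i))

mutual
  eval : ∀ {σ m Δ} (M : Structure σ) → Formula σ m Δ →
         Vec (Fin (size M)) m → Env Δ (size M) → Bool
  eval M (eq x y)     ρ ε = ⌊ lookup ρ x ≟ lookup ρ y ⌋
  eval M (rel r ts)   ρ ε = relOf M r (map (lookup ρ) ts)
  eval M (rvar i ts)  ρ ε = ε i (map (lookup ρ) ts)
  eval M (neg φ)      ρ ε = not (eval M φ ρ ε)
  eval M (and φ ψ)    ρ ε = eval M φ ρ ε ∧ eval M ψ ρ ε
  eval M (ex φ)       ρ ε = anyFin (λ a → eval M φ (a ∷ ρ) ε)
  eval M (lfp k φ us) ρ ε = stage M k φ ρ ε (size M ^ k) (map (lookup ρ) us)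

  -- stage ... s = ⋃_{η < s} I^η, where I^η = Γ(⋃_{ξ<η} I^ξ) and
  -- Γ(X) = { t : φ(t, params; X) }.  On a structure of size n these
  -- cumulative stages increase and stabilise by s = n^k, so
  -- stage (n^k) is the union of all stages, i.e. the least fixed point.
  stage : ∀ {σ m Δ} (M : Structure σ) k → Formula σ (k + m) (k ∷ Δ) →
          Vec (Fin (size M)) m → Env Δ (size M) → ℕ →
          Vec (Fin (size M)) k → Bool
  stage M k φ ρ ε zero    t = false
  stage M k φ ρ ε (suc s) t =
    stage M k φ ρ ε s t ∨ eval M φ (t ++ ρ) (envCons (stage M k φ ρ ε s) ε)

-- Partitioned LFP formulas φ(x;y), |x| = p, |y| = q, no free relation
-- variables; x are the first p variables.

Sat : ∀ {σ p q} → Formula σ (p + q) [] → (M : Structure σ) →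
      Vec (Fin (size M)) p → Vec (Fin (size M)) q → Set
Sat φ M a b = T (eval M φ (a ++ b) (λ ()))

StrictSub : ∀ {σ p q} → Formula σ (p + q) [] → (M : Structure σ) →
            Vec (Fin (size M)) q → Vec (Fin (size M)) q → Set
StrictSub {p = p} φ M b b' =
  ((a : Vec (Fin (size M)) p) → Sat φ M a b → Sat φ M a b')
  × (Σ (Vec (Fin (size M)) p) λ a → ¬ Sat φ M a b × Sat φ M a b')

SOP : ∀ {σ} p q → Formula σ (p + q) [] → Structure σ → ℕ → Set
SOP p q φ M n =
  Σ (List (Vec (Fin (size M)) q)) λ bs →
    length bs ≡ n × Linked (StrictSub φ M) bs

-- IP(n): b indexed directly by subsets of {1..n}
IP : ∀ {σ} p q → Formula σ (p + q) [] → Structure σ → ℕ → Set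
IP p q φ M n =
  Σ (Fin n → Vec (Fin (size M)) p) λ a →
  Σ (Subset n → Vec (Fin (size M)) q) λ b →
    (i : Fin n) (J : Subset n) → Sat φ M (a i) (b J) ⇔ i ∈ J

TP2 : ∀ {σ} p q → Formula σ (p + q) [] → Structure σ → ℕ → Set
TP2 p q φ M n =
  Σ (Fin n → Fin n → Vec (Fin (size M)) q) λ b →
    ((i j k : Fin n) → j ≢ k → (a : Vec (Fin (size M)) p) →
        ¬ (Sat φ M a (b i j) × Sat φ M a (b i k)))
    × ((f : Fin n → Fin n) →
        Σ (Vec (Fin (size M)) p) λ a → (i : Fin n) → Sat φ M a (b i (f i)))

HasLFP : ∀ {σ} → (∀ p q → Formula σ (p + q) [] → Structure σ → ℕ → Set) →
         (Structure σ → Set) → Set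
HasLFP {σ} P C =
  Σ ℕ λ p → Σ ℕ λ q → Σ (Formula σ (p + q) []) λ φ →
    WF φ × ((n : ℕ) → Σ (Structure σ) λ M → C M × P p q φ M n)

module Submission where

-- Let φ(x; y) have sOP(n) for all n.  The strict inclusion
-- φ(M^x; c) ⊊ φ(M^x; b) is first-order, so the height of b (the length of
-- the longest ⊊-chain ending in b) is LFP-definable as an order: "height b ≤
-- height b'" is a least fixed point, and so are =, <, zero and successor on
-- heights.  Heights form an initial segment of ℕ, and a ⊊-chain of length
-- n + 2 gives heights up to n.  With this arithmetic an LFP counter computes
-- digits: Digit(y, m, t, r) holds iff the digit of height y at weight height m
-- in base height t is height r.  Digit has TP2(n) (row i asks for base-n digit
-- i to be j) and, with the variables swapped, IP(n) (binary digits encode sets).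

open import Defs
open import Data.Nat using (ℕ; zero; suc; _+_; _*_; _^_; _≤_; _<_; z≤n; s≤s; _⊔_)
open import Data.Nat.Properties
open import Data.Bool using (Bool; true; false; _∧_; _∨_; not; T; if_then_else_)
open import Data.Bool.Properties using (T-∧; T-∨)
open import Data.Fin using (Fin; zero; suc; toℕ; fromℕ<; _↑ˡ_; _↑ʳ_)
open import Data.Fin.Properties using (toℕ<n; toℕ-injective)
import Data.Fin.Properties as Fin
open import Data.Fin.Subset using (Subset; _∈_)
open import Data.Vec using (Vec; []; _∷_; lookup; map; _++_; allFin; replicate; splitAt; take; drop)
open import Data.Vec.Properties
  using (map-++; map-cong; map-∘; lookup-map; lookup-++ˡ; lookup-++ʳ; map-lookup-allFin;
         []=⇒lookup; lookup⇒[]=; take++drop≡id; ++-injectiveˡ; ++-injectiveʳ)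
open import Data.List using (List; []; _∷_; length)
open import Data.List.Relation.Unary.Linked using (Linked; [-]; _∷_)
open import Data.Product using (Σ; _×_; ∃; _,_; proj₁; proj₂)
open import Data.Sum using (_⊎_; inj₁; inj₂)
open import Data.Empty using (⊥; ⊥-elim)
open import Function.Bundles using (Equivalence; mk⇔)
open import Relation.Nullary using (¬_; yes; no)
open import Relation.Nullary.Decidable using (T?; decidable-stable)
open import Relation.Binary.PropositionalEquality
  using (_≡_; _≢_; refl; sym; trans; cong; cong₂; subst; subst₂; module ≡-Reasoning)

Iff : Set → Set → Set
Iff A B = (A → B) × (B → A)

T∧-elim : ∀ {a b} → T (a ∧ b) → T a × T b
T∧-elim = Equivalence.to T-∧

T∧-intro : ∀ {a b} → T a → T b → T (a ∧ b)
T∧-intro x y = Equivalence.from T-∧ (x , y)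

T∨-elim : ∀ {a b} → T (a ∨ b) → T a ⊎ T b
T∨-elim = Equivalence.to T-∨

T∨-introʳ : ∀ {a b} → T b → T (a ∨ b)
T∨-introʳ y = Equivalence.from T-∨ (inj₂ y)

T-not-elim : ∀ {a} → T (not a) → ¬ T a
T-not-elim {true} () _

T-not-intro : ∀ {a} → ¬ T a → T (not a)
T-not-intro {true}  h = h _
T-not-intro {false} h = _

T-stable : ∀ {a} → ¬ ¬ T a → T a
T-stable {a} = decidable-stable (T? a)

T-to : ∀ {a b} → a ≡ b → T a → T b
T-to = subst T

T-from : ∀ {a b} → a ≡ b → T b → T a
T-from e = subst T (sym e)

anyFin-cong : ∀ {n} {f g : Fin n → Bool} → (∀ i → f i ≡ g i) → anyFin f ≡ anyFin g
anyFin-cong {zero}  h = refl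
anyFin-cong {suc n} h = cong₂ _∨_ (h zero) (anyFin-cong (λ i → h (suc i)))

anyFin-witness : ∀ {n} {f : Fin n → Bool} → T (anyFin f) → ∃ λ i → T (f i)
anyFin-witness {suc n} {f} h with T∨-elim {f zero} h
... | inj₁ t = zero , t
... | inj₂ t with anyFin-witness {n} {λ i → f (suc i)} t
...   | i , u = suc i , u

anyFin-intro : ∀ {n} {f : Fin n → Bool} i → T (f i) → T (anyFin f)
anyFin-intro {suc n} {f} zero    t = Equivalence.from T-∨ (inj₁ t)
anyFin-intro {suc n} {f} (suc i) t = T∨-introʳ {f zero} (anyFin-intro {n} {λ j → f (suc j)} i t)

liftV : ∀ {m m'} k → (Fin m → Fin m') → Fin (k + m) → Fin (k + m')
liftV zero    f = f
liftV (suc k) f zero    = zero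
liftV (suc k) f (suc x) = suc (liftV k f x)

liftR : ∀ (Δ Δ' : List ℕ) k → (RVar Δ → RVar Δ') → RVar (k ∷ Δ) → RVar (k ∷ Δ')
liftR Δ Δ' k r zero    = zero
liftR Δ Δ' k r (suc i) = suc (r i)

REq : ∀ (Δ Δ' : List ℕ) → (RVar Δ → RVar Δ') → Set
REq Δ Δ' r = ∀ i → Data.List.lookup Δ' (r i) ≡ Data.List.lookup Δ i

liftE : ∀ (Δ Δ' : List ℕ) k r → REq Δ Δ' r → REq (k ∷ Δ) (k ∷ Δ') (liftR Δ Δ' k r)
liftE Δ Δ' k r e zero    = refl
liftE Δ Δ' k r e (suc i) = e i

Inj : ∀ (Δ Δ' : List ℕ) → (RVar Δ → RVar Δ') → Set
Inj Δ Δ' r = ∀ {a b} → r a ≡ r b → a ≡ b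

liftR-inj : ∀ Δ Δ' k (r : RVar Δ → RVar Δ') → Inj Δ Δ' r → Inj (k ∷ Δ) (k ∷ Δ') (liftR Δ Δ' k r)
liftR-inj Δ Δ' k r ir {zero}  {zero}  e = refl
liftR-inj Δ Δ' k r ir {suc a} {suc b} e = cong suc (ir (Fin.suc-injective e))
liftR-inj Δ Δ' k r ir {zero}  {suc b} ()
liftR-inj Δ Δ' k r ir {suc a} {zero}  ()

liftV-lookup : ∀ {S : Set} {m m'} k (f : Fin m → Fin m') (ρ : Vec S m) (ρ' : Vec S m') →
  (∀ x → lookup ρ' (f x) ≡ lookup ρ x) → (t : Vec S k) →
  ∀ x → lookup (t ++ ρ') (liftV k f x) ≡ lookup (t ++ ρ) x
liftV-lookup zero    f ρ ρ' h []      x       = h x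
liftV-lookup (suc k) f ρ ρ' h (a ∷ t) zero    = refl
liftV-lookup (suc k) f ρ ρ' h (a ∷ t) (suc x) = liftV-lookup k f ρ ρ' h t x

map-subst : ∀ {A B : Set} {a b} (g : A → B) (p : a ≡ b) (v : Vec A a) →
            map g (subst (Vec A) p v) ≡ subst (Vec B) p (map g v)
map-subst g refl v = refl

module _ {σ : Signature} where
  ren : ∀ {m m' Δ Δ'} (f : Fin m → Fin m') (r : RVar Δ → RVar Δ') (e : REq Δ Δ' r) →
        Formula σ m Δ → Formula σ m' Δ'
  ren f r e (eq x y)   = eq (f x) (f y)
  ren f r e (rel R ts) = rel R (map f ts)
  ren {m' = m'} f r e (rvar i ts) = rvar (r i) (subst (Vec (Fin m')) (sym (e i)) (map f ts))
  ren f r e (neg φ)    = neg (ren f r e φ)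
  ren f r e (and φ ψ)  = and (ren f r e φ) (ren f r e ψ)
  ren f r e (ex φ)     = ex (ren (liftV 1 f) r e φ)
  ren {Δ = Δ} {Δ'} f r e (lfp k φ us) =
    lfp k (ren (liftV k f) (liftR Δ Δ' k r) (liftE Δ Δ' k r e) φ) (map f us)

  module EvalLemmas (M : Structure σ) where
    S : Set
    S = Fin (size M)

    map-lookup-ren : ∀ {m m' n} (f : Fin m → Fin m') (ρ : Vec S m) (ρ' : Vec S m') →
      (∀ x → lookup ρ' (f x) ≡ lookup ρ x) → (us : Vec (Fin m) n) →
      map (lookup ρ') (map f us) ≡ map (lookup ρ) us
    map-lookup-ren f ρ ρ' h us = trans (sym (map-∘ (lookup ρ') f us)) (map-cong h us)

    mutual
      eval-ren : ∀ {m m' Δ Δ'} (φ : Formula σ m Δ) f (r : RVar Δ → RVar Δ') (e : REq Δ Δ' r)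
        (ρ : Vec S m) (ρ' : Vec S m') (ε : Env Δ (size M)) (ε' : Env Δ' (size M)) →
        (∀ x → lookup ρ' (f x) ≡ lookup ρ x) →
        (∀ i v → ε' (r i) (subst (Vec S) (sym (e i)) v) ≡ ε i v) →
        eval M (ren {Δ = Δ} {Δ'} f r e φ) ρ' ε' ≡ eval M φ ρ ε
      eval-ren (eq x y) f r e ρ ρ' ε ε' h he rewrite h x | h y = refl
      eval-ren (rel R ts) f r e ρ ρ' ε ε' h he = cong (relOf M R) (map-lookup-ren f ρ ρ' h ts)
      eval-ren (rvar i ts) f r e ρ ρ' ε ε' h he =
        trans (cong (ε' (r i)) (map-subst (lookup ρ') (sym (e i)) (map f ts)))
          (trans (cong (λ v → ε' (r i) (subst (Vec S) (sym (e i)) v)) (map-lookup-ren f ρ ρ' h ts))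
                 (he i (map (lookup ρ) ts)))
      eval-ren {Δ = Δ} {Δ'} (neg φ) f r e ρ ρ' ε ε' h he =
        cong not (eval-ren {Δ = Δ} {Δ'} φ f r e ρ ρ' ε ε' h he)
      eval-ren {Δ = Δ} {Δ'} (and φ ψ) f r e ρ ρ' ε ε' h he =
        cong₂ _∧_ (eval-ren {Δ = Δ} {Δ'} φ f r e ρ ρ' ε ε' h he) (eval-ren {Δ = Δ} {Δ'} ψ f r e ρ ρ' ε ε' h he)
      eval-ren {Δ = Δ} {Δ'} (ex φ) f r e ρ ρ' ε ε' h he =
        anyFin-cong (λ a → eval-ren {Δ = Δ} {Δ'} φ (liftV 1 f) r e (a ∷ ρ) (a ∷ ρ') ε ε'
                              (liftV-lookup 1 f ρ ρ' h (a ∷ [])) he)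
      eval-ren {Δ = Δ} {Δ'} (lfp k φ us) f r e ρ ρ' ε ε' h he =
        trans (cong (stage M k (ren {Δ = k ∷ Δ} {k ∷ Δ'} (liftV k f) (liftR Δ Δ' k r) (liftE Δ Δ' k r e) φ) ρ' ε' (size M ^ k))
                    (map-lookup-ren f ρ ρ' h us))
              (stage-ren {Δ = Δ} {Δ'} k φ f r e ρ ρ' ε ε' h he (size M ^ k) (map (lookup ρ) us))

      stage-ren : ∀ {m m' Δ Δ'} k (φ : Formula σ (k + m) (k ∷ Δ)) f (r : RVar Δ → RVar Δ') (e : REq Δ Δ' r)
        (ρ : Vec S m) (ρ' : Vec S m') (ε : Env Δ (size M)) (ε' : Env Δ' (size M)) →
        (∀ x → lookup ρ' (f x) ≡ lookup ρ x) →
        (∀ i v → ε' (r i) (subst (Vec S) (sym (e i)) v) ≡ ε i v) →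
        ∀ n t → stage M k (ren {Δ = k ∷ Δ} {k ∷ Δ'} (liftV k f) (liftR Δ Δ' k r) (liftE Δ Δ' k r e) φ) ρ' ε' n t
              ≡ stage M k φ ρ ε n t
      stage-ren k φ f r e ρ ρ' ε ε' h he zero t = refl
      stage-ren {Δ = Δ} {Δ'} k φ f r e ρ ρ' ε ε' h he (suc n) t =
        cong₂ _∨_ (stage-ren {Δ = Δ} {Δ'} k φ f r e ρ ρ' ε ε' h he n t)
          (eval-ren {Δ = k ∷ Δ} {k ∷ Δ'} φ (liftV k f) (liftR Δ Δ' k r) (liftE Δ Δ' k r e) (t ++ ρ) (t ++ ρ')
             (envCons {Δ} {size M} {k} (stage M k φ ρ ε n) ε)
             (envCons {Δ'} {size M} {k} (stage M k φ' ρ' ε' n) ε')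
             (liftV-lookup k f ρ ρ' h t) env)
        where
        φ' : Formula σ (k + _) (k ∷ Δ')
        φ' = ren {Δ = k ∷ Δ} {k ∷ Δ'} (liftV k f) (liftR Δ Δ' k r) (liftE Δ Δ' k r e) φ
        env : ∀ i v → envCons {Δ'} {size M} {k} (stage M k φ' ρ' ε' n) ε'
                         (liftR Δ Δ' k r i) (subst (Vec S) (sym (liftE Δ Δ' k r e i)) v)
                      ≡ envCons {Δ} {size M} {k} (stage M k φ ρ ε n) ε i v
        env zero    v = stage-ren {Δ = Δ} {Δ'} k φ f r e ρ ρ' ε ε' h he n v
        env (suc i) v = he i v

    mutual
      eval-cong : ∀ {m Δ} (φ : Formula σ m Δ) (ρ : Vec S m) (ε ε' : Env Δ (size M)) →
        (∀ i v → ε i v ≡ ε' i v) → eval M φ ρ ε ≡ eval M φ ρ ε'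
      eval-cong (eq x y) ρ ε ε' h = refl
      eval-cong (rel R ts) ρ ε ε' h = refl
      eval-cong (rvar i ts) ρ ε ε' h = h i _
      eval-cong (neg φ) ρ ε ε' h = cong not (eval-cong φ ρ ε ε' h)
      eval-cong (and φ ψ) ρ ε ε' h = cong₂ _∧_ (eval-cong φ ρ ε ε' h) (eval-cong ψ ρ ε ε' h)
      eval-cong (ex φ) ρ ε ε' h = anyFin-cong (λ a → eval-cong φ (a ∷ ρ) ε ε' h)
      eval-cong (lfp k φ us) ρ ε ε' h = stage-cong k φ ρ ε ε' h (size M ^ k) _

      stage-cong : ∀ {m Δ} k (φ : Formula σ (k + m) (k ∷ Δ)) (ρ : Vec S m) (ε ε' : Env Δ (size M)) →
        (∀ i v → ε i v ≡ ε' i v) → ∀ n t → stage M k φ ρ ε n t ≡ stage M k φ ρ ε' n t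
      stage-cong k φ ρ ε ε' h zero t = refl
      stage-cong {Δ = Δ} k φ ρ ε ε' h (suc n) t =
        cong₂ _∨_ (stage-cong k φ ρ ε ε' h n t)
          (eval-cong φ (t ++ ρ) (envCons {Δ} {size M} {k} (stage M k φ ρ ε n) ε)
                                (envCons {Δ} {size M} {k} (stage M k φ ρ ε' n) ε') env)
        where
        env : ∀ i v → envCons {Δ} {size M} {k} (stage M k φ ρ ε n) ε i v
                    ≡ envCons {Δ} {size M} {k} (stage M k φ ρ ε' n) ε' i v
        env zero    v = stage-cong k φ ρ ε ε' h n v
        env (suc i) v = h i v

  mutual
    pos-ren : ∀ {m m' Δ Δ'} (φ : Formula σ m Δ) {i} (f : Fin m → Fin m') (r : RVar Δ → RVar Δ')
              (e : REq Δ Δ' r) → Inj Δ Δ' r → Pos i φ → Pos (r i) (ren {Δ = Δ} {Δ'} f r e φ)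
    pos-ren (eq x y) f r e ir p-eq = p-eq
    pos-ren (rel R ts) f r e ir p-rel = p-rel
    pos-ren (rvar j ts) f r e ir p-rvar = p-rvar
    pos-ren (neg φ) f r e ir (p-neg x) = p-neg (neg-ren φ f r e ir x)
    pos-ren (and φ ψ) f r e ir (p-and x y) = p-and (pos-ren φ f r e ir x) (pos-ren ψ f r e ir y)
    pos-ren (ex φ) f r e ir (p-ex x) = p-ex (pos-ren φ (liftV 1 f) r e ir x)
    pos-ren {Δ = Δ} {Δ'} (lfp k φ us) f r e ir (p-lfp x) =
      p-lfp (pos-ren {Δ = k ∷ Δ} {k ∷ Δ'} φ (liftV k f) (liftR Δ Δ' k r) (liftE Δ Δ' k r e) (liftR-inj Δ Δ' k r ir) x)

    neg-ren : ∀ {m m' Δ Δ'} (φ : Formula σ m Δ) {i} (f : Fin m → Fin m') (r : RVar Δ → RVar Δ')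
              (e : REq Δ Δ' r) → Inj Δ Δ' r → Neg i φ → Neg (r i) (ren {Δ = Δ} {Δ'} f r e φ)
    neg-ren (eq x y) f r e ir n-eq = n-eq
    neg-ren (rel R ts) f r e ir n-rel = n-rel
    neg-ren (rvar j ts) f r e ir (n-rvar ne) = n-rvar (λ q → ne (ir q))
    neg-ren (neg φ) f r e ir (n-neg x) = n-neg (pos-ren φ f r e ir x)
    neg-ren (and φ ψ) f r e ir (n-and x y) = n-and (neg-ren φ f r e ir x) (neg-ren ψ f r e ir y)
    neg-ren (ex φ) f r e ir (n-ex x) = n-ex (neg-ren φ (liftV 1 f) r e ir x)
    neg-ren {Δ = Δ} {Δ'} (lfp k φ us) f r e ir (n-lfp x) =
      n-lfp (neg-ren {Δ = k ∷ Δ} {k ∷ Δ'} φ (liftV k f) (liftR Δ Δ' k r) (liftE Δ Δ' k r e) (liftR-inj Δ Δ' k r ir) x)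

  wf-ren : ∀ {m m' Δ Δ'} (φ : Formula σ m Δ) (f : Fin m → Fin m') (r : RVar Δ → RVar Δ')
           (e : REq Δ Δ' r) → Inj Δ Δ' r → WF φ → WF (ren {Δ = Δ} {Δ'} f r e φ)
  wf-ren (eq x y) f r e ir w-eq = w-eq
  wf-ren (rel R ts) f r e ir w-rel = w-rel
  wf-ren (rvar j ts) f r e ir w-rvar = w-rvar
  wf-ren (neg φ) f r e ir (w-neg w) = w-neg (wf-ren φ f r e ir w)
  wf-ren (and φ ψ) f r e ir (w-and w v) = w-and (wf-ren φ f r e ir w) (wf-ren ψ f r e ir v)
  wf-ren (ex φ) f r e ir (w-ex w) = w-ex (wf-ren φ (liftV 1 f) r e ir w)
  wf-ren {Δ = Δ} {Δ'} (lfp k φ us) f r e ir (w-lfp p w) =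
    w-lfp (pos-ren {Δ = k ∷ Δ} {k ∷ Δ'} φ (liftV k f) (liftR Δ Δ' k r) (liftE Δ Δ' k r e) (liftR-inj Δ Δ' k r ir) p)
          (wf-ren {Δ = k ∷ Δ} {k ∷ Δ'} φ (liftV k f) (liftR Δ Δ' k r) (liftE Δ Δ' k r e) (liftR-inj Δ Δ' k r ir) w)

  -- A relation variable outside the image of r does not occur in a renamed
  -- formula at all: it occurs both only positively and only negatively.
  lift-fresh : ∀ {Δ Δ'} k (r : RVar Δ → RVar Δ') {j} → (∀ i → r i ≢ j) →
               ∀ i → liftR Δ Δ' k r i ≢ suc j
  lift-fresh k r nr zero    ()
  lift-fresh k r nr (suc i) q = nr i (Fin.suc-injective q)

  mutual
    fresh-pos : ∀ {m m' Δ Δ'} (φ : Formula σ m Δ) {j} (f : Fin m → Fin m') (r : RVar Δ → RVar Δ')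
                (e : REq Δ Δ' r) → (∀ i → r i ≢ j) → Pos j (ren {Δ = Δ} {Δ'} f r e φ)
    fresh-pos (eq x y) f r e nr = p-eq
    fresh-pos (rel R ts) f r e nr = p-rel
    fresh-pos (rvar i ts) f r e nr = p-rvar
    fresh-pos (neg φ) f r e nr = p-neg (fresh-neg φ f r e nr)
    fresh-pos (and φ ψ) f r e nr = p-and (fresh-pos φ f r e nr) (fresh-pos ψ f r e nr)
    fresh-pos (ex φ) f r e nr = p-ex (fresh-pos φ (liftV 1 f) r e nr)
    fresh-pos {Δ = Δ} {Δ'} (lfp k φ us) f r e nr =
      p-lfp (fresh-pos {Δ = k ∷ Δ} {k ∷ Δ'} φ (liftV k f) (liftR Δ Δ' k r) (liftE Δ Δ' k r e) (lift-fresh k r nr))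

    fresh-neg : ∀ {m m' Δ Δ'} (φ : Formula σ m Δ) {j} (f : Fin m → Fin m') (r : RVar Δ → RVar Δ')
                (e : REq Δ Δ' r) → (∀ i → r i ≢ j) → Neg j (ren {Δ = Δ} {Δ'} f r e φ)
    fresh-neg (eq x y) f r e nr = n-eq
    fresh-neg (rel R ts) f r e nr = n-rel
    fresh-neg (rvar i ts) f r e nr = n-rvar (λ q → nr i (sym q))
    fresh-neg (neg φ) f r e nr = n-neg (fresh-pos φ f r e nr)
    fresh-neg (and φ ψ) f r e nr = n-and (fresh-neg φ f r e nr) (fresh-neg ψ f r e nr)
    fresh-neg (ex φ) f r e nr = n-ex (fresh-neg φ (liftV 1 f) r e nr)
    fresh-neg {Δ = Δ} {Δ'} (lfp k φ us) f r e nr =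
      n-lfp (fresh-neg {Δ = k ∷ Δ} {k ∷ Δ'} φ (liftV k f) (liftR Δ Δ' k r) (liftE Δ Δ' k r e) (lift-fresh k r nr))


-- In a scope k + m (k freshly bound variables in
-- front of an outer scope m), front m vs names fresh variables and
-- under k vs names outer ones; first n lists the n fresh variables in order.

front : ∀ {n} m {k} → Vec (Fin n) k → Vec (Fin (n + m)) k
front m vs = map (_↑ˡ m) vs

under : ∀ {m} k {j} → Vec (Fin m) j → Vec (Fin (k + m)) j
under k vs = map (k ↑ʳ_) vs

first : ∀ n {m} → Vec (Fin (n + m)) n
first n {m} = front m (allFin n)

module _ {S : Set} where
  ⟦_⟧ : ∀ {m k} → Vec (Fin m) k → Vec S m → Vec S k
  ⟦ vs ⟧ ρ = map (lookup ρ) vs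

  ⟦all⟧ : ∀ {n} (ρ : Vec S n) → ⟦ allFin n ⟧ ρ ≡ ρ
  ⟦all⟧ ρ = map-lookup-allFin ρ

  ⟦front⟧ : ∀ {n m k} (t : Vec S n) (ρ : Vec S m) (vs : Vec (Fin n) k) → ⟦ front m vs ⟧ (t ++ ρ) ≡ ⟦ vs ⟧ t
  ⟦front⟧ t ρ vs = trans (sym (map-∘ (lookup (t ++ ρ)) _ vs)) (map-cong (λ i → lookup-++ˡ t ρ i) vs)

  ⟦under⟧ : ∀ {m k j} (t : Vec S k) (ρ : Vec S m) (vs : Vec (Fin m) j) → ⟦ under k vs ⟧ (t ++ ρ) ≡ ⟦ vs ⟧ ρ
  ⟦under⟧ t ρ vs = trans (sym (map-∘ (lookup (t ++ ρ)) _ vs)) (map-cong (λ i → lookup-++ʳ t ρ i) vs)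

  ⟦first⟧ : ∀ {n m} (t : Vec S n) (ρ : Vec S m) → ⟦ first n ⟧ (t ++ ρ) ≡ t
  ⟦first⟧ t ρ = trans (⟦front⟧ t ρ (allFin _)) (⟦all⟧ t)

  ⟦++⟧ : ∀ {m a b} (us : Vec (Fin m) a) (vs : Vec (Fin m) b) (ρ : Vec S m) {x y} →
         ⟦ us ⟧ ρ ≡ x → ⟦ vs ⟧ ρ ≡ y → ⟦ us ++ vs ⟧ ρ ≡ x ++ y
  ⟦++⟧ us vs ρ e₁ e₂ = trans (map-++ (lookup ρ) us vs) (cong₂ _++_ e₁ e₂)

module _ {A : Set} where
  data Split (a b : ℕ) : Vec A (a + b) → Set where
    split-as : (u : Vec A a) (v : Vec A b) → Split a b (u ++ v)

  split : ∀ a b (t : Vec A (a + b)) → Split a b t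
  split a b t with splitAt a t
  ... | u , v , refl = split-as u v

  data Split₄ (a b c d : ℕ) : Vec A (a + (b + (c + d))) → Set where
    split₄-as : (u : Vec A a) (v : Vec A b) (w : Vec A c) (x : Vec A d) → Split₄ a b c d (u ++ (v ++ (w ++ x)))

  split₄ : ∀ a b c d (t : Vec A (a + (b + (c + d)))) → Split₄ a b c d t
  split₄ a b c d t with split a (b + (c + d)) t
  ... | split-as u t' with split b (c + d) t'
  ...   | split-as v t'' with split c d t''
  ...     | split-as w x = split₄-as u v w x

  take-++ : ∀ {a b} (u : Vec A a) (v : Vec A b) → take a (u ++ v) ≡ u
  take-++ {a} u v = ++-injectiveˡ (take a (u ++ v)) u (take++drop≡id a (u ++ v))

  drop-++ : ∀ {a b} (u : Vec A a) (v : Vec A b) → drop a (u ++ v) ≡ v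
  drop-++ {a} u v = ++-injectiveʳ (take a (u ++ v)) u (take++drop≡id a (u ++ v))

  take-drop-++ : ∀ {a b c} (u : Vec A a) (v : Vec A b) (w : Vec A c) → take b (drop a (u ++ (v ++ w))) ≡ v
  take-drop-++ {b = b} u v w = trans (cong (take b) (drop-++ u (v ++ w))) (take-++ v w)

module _ {σ : Signature} where
  inst : ∀ {n m Δ} → Formula σ n [] → Vec (Fin m) n → Formula σ m Δ
  inst {Δ = Δ} ψ vs = ren {Δ = []} {Δ} (lookup vs) (λ ()) (λ ()) ψ

  or : ∀ {m Δ} → Formula σ m Δ → Formula σ m Δ → Formula σ m Δ
  or a b = neg (and (neg a) (neg b))

  imp : ∀ {m Δ} → Formula σ m Δ → Formula σ m Δ → Formula σ m Δ
  imp a b = neg (and a (neg b))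

  exq : ∀ {m Δ} q → Formula σ (q + m) Δ → Formula σ m Δ
  exq zero    ψ = ψ
  exq (suc q) ψ = exq q (ex ψ)

  allq : ∀ {m Δ} q → Formula σ (q + m) Δ → Formula σ m Δ
  allq q ψ = neg (exq q (neg ψ))

  ε₀ : ∀ {n} → Env [] n
  ε₀ ()

  module ConnectiveSemantics (M : Structure σ) where
    open EvalLemmas M

    inst-sem : ∀ {n m} Δ (ψ : Formula σ n []) (vs : Vec (Fin m) n) (ρ : Vec S m) (ε : Env Δ (size M)) →
      eval M (inst ψ vs) ρ ε ≡ eval M ψ (⟦ vs ⟧ ρ) ε₀
    inst-sem Δ ψ vs ρ ε = eval-ren {Δ = []} {Δ} ψ (lookup vs) (λ ()) (λ ()) (⟦ vs ⟧ ρ) ρ ε₀ ε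
      (λ x → sym (lookup-map x (lookup ρ) vs)) (λ ())

    env₀ : ∀ {n} (ψ : Formula σ n []) ρ (ε : Env [] (size M)) → eval M ψ ρ ε ≡ eval M ψ ρ ε₀
    env₀ ψ ρ ε = eval-cong ψ ρ ε ε₀ (λ ())

    exq-elim : ∀ {m} Δ q (ψ : Formula σ (q + m) Δ) ρ ε → T (eval M (exq q ψ) ρ ε) →
               ∃ λ (t : Vec S q) → T (eval M ψ (t ++ ρ) ε)
    exq-elim Δ zero    ψ ρ ε h = [] , h
    exq-elim Δ (suc q) ψ ρ ε h with exq-elim Δ q (ex ψ) ρ ε h
    ... | t , h' with anyFin-witness h'
    ...   | a , h'' = (a ∷ t) , h''

    exq-intro : ∀ {m} Δ q (ψ : Formula σ (q + m) Δ) ρ ε (t : Vec S q) → T (eval M ψ (t ++ ρ) ε) →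
                T (eval M (exq q ψ) ρ ε)
    exq-intro Δ zero    ψ ρ ε []      h = h
    exq-intro Δ (suc q) ψ ρ ε (a ∷ t) h = exq-intro Δ q (ex ψ) ρ ε t (anyFin-intro a h)

    allq-elim : ∀ {m} Δ q (ψ : Formula σ (q + m) Δ) ρ ε → T (eval M (allq q ψ) ρ ε) →
                ∀ (t : Vec S q) → T (eval M ψ (t ++ ρ) ε)
    allq-elim Δ q ψ ρ ε h t = T-stable (λ nt → T-not-elim h (exq-intro Δ q (neg ψ) ρ ε t (T-not-intro nt)))

    allq-intro : ∀ {m} Δ q (ψ : Formula σ (q + m) Δ) ρ ε → (∀ (t : Vec S q) → T (eval M ψ (t ++ ρ) ε)) →
                 T (eval M (allq q ψ) ρ ε)
    allq-intro Δ q ψ ρ ε h = T-not-intro (λ e → let (t , u) = exq-elim Δ q (neg ψ) ρ ε e in T-not-elim u (h t))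

    or-elim : ∀ {m} Δ (a b : Formula σ m Δ) ρ ε → T (eval M (or a b) ρ ε) → T (eval M a ρ ε) ⊎ T (eval M b ρ ε)
    or-elim Δ a b ρ ε h with T? (eval M a ρ ε)
    ... | yes x = inj₁ x
    ... | no na = inj₂ (T-stable (λ nb → T-not-elim h (T∧-intro (T-not-intro na) (T-not-intro nb))))

    or-introˡ : ∀ {m} Δ (a b : Formula σ m Δ) ρ ε → T (eval M a ρ ε) → T (eval M (or a b) ρ ε)
    or-introˡ Δ a b ρ ε h = T-not-intro (λ u → T-not-elim (proj₁ (T∧-elim u)) h)

    or-introʳ : ∀ {m} Δ (a b : Formula σ m Δ) ρ ε → T (eval M b ρ ε) → T (eval M (or a b) ρ ε)
    or-introʳ Δ a b ρ ε h = T-not-intro (λ u → T-not-elim (proj₂ (T∧-elim {not (eval M a ρ ε)} u)) h)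

    imp-elim : ∀ {m} Δ (a b : Formula σ m Δ) ρ ε → T (eval M (imp a b) ρ ε) → T (eval M a ρ ε) → T (eval M b ρ ε)
    imp-elim Δ a b ρ ε h ta = T-stable (λ nb → T-not-elim h (T∧-intro ta (T-not-intro nb)))

    imp-intro : ∀ {m} Δ (a b : Formula σ m Δ) ρ ε → (T (eval M a ρ ε) → T (eval M b ρ ε)) → T (eval M (imp a b) ρ ε)
    imp-intro Δ a b ρ ε h = T-not-intro (λ u → let (x , y) = T∧-elim u in T-not-elim y (h x))

  -- A relation
  -- variable that is "absent" (Both: positive and negative) from the parts
  -- is absent from the whole; instances of closed formulas are absent.
  Both : ∀ {m Δ} → RVar Δ → Formula σ m Δ → Set
  Both i φ = Pos i φ × Neg i φ

  both-inst : ∀ {n m Δ} (ψ : Formula σ n []) (vs : Vec (Fin m) n) (j : RVar Δ) → Both j (inst ψ vs)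
  both-inst {Δ = Δ} ψ vs j =
    fresh-pos {Δ = []} {Δ} ψ (lookup vs) (λ ()) (λ ()) (λ ()) , fresh-neg {Δ = []} {Δ} ψ (lookup vs) (λ ()) (λ ()) (λ ())

  both-neg : ∀ {m Δ} {i : RVar Δ} {φ : Formula σ m Δ} → Both i φ → Both i (neg φ)
  both-neg (p , n) = p-neg n , n-neg p

  both-and : ∀ {m Δ} {i : RVar Δ} {φ ψ : Formula σ m Δ} → Both i φ → Both i ψ → Both i (and φ ψ)
  both-and (p , n) (p' , n') = p-and p p' , n-and n n'

  both-or : ∀ {m Δ} {i : RVar Δ} {φ ψ : Formula σ m Δ} → Both i φ → Both i ψ → Both i (or φ ψ)
  both-or a b = both-neg (both-and (both-neg a) (both-neg b))

  pos-exq : ∀ {m Δ} q {i : RVar Δ} {φ : Formula σ (q + m) Δ} → Pos i φ → Pos i (exq q φ)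
  pos-exq zero    p = p
  pos-exq (suc q) p = pos-exq q (p-ex p)

  neg-exq : ∀ {m Δ} q {i : RVar Δ} {φ : Formula σ (q + m) Δ} → Neg i φ → Neg i (exq q φ)
  neg-exq zero    p = p
  neg-exq (suc q) p = neg-exq q (n-ex p)

  pos-or : ∀ {m Δ} {i : RVar Δ} {φ ψ : Formula σ m Δ} → Pos i φ → Pos i ψ → Pos i (or φ ψ)
  pos-or a b = p-neg (n-and (n-neg a) (n-neg b))

  pos-imp : ∀ {m Δ} {i : RVar Δ} {φ ψ : Formula σ m Δ} → Neg i φ → Pos i ψ → Pos i (imp φ ψ)
  pos-imp a b = p-neg (n-and a (n-neg b))

  pos-allq : ∀ {m Δ} q {i : RVar Δ} {φ : Formula σ (q + m) Δ} → Pos i φ → Pos i (allq q φ)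
  pos-allq q p = p-neg (neg-exq q (n-neg p))

  wf-inst : ∀ {n m Δ} (ψ : Formula σ n []) (vs : Vec (Fin m) n) → WF ψ → WF {m = m} {Δ} (inst ψ vs)
  wf-inst {Δ = Δ} ψ vs w = wf-ren {Δ = []} {Δ} ψ (lookup vs) (λ ()) (λ ()) (λ {}) w

  wf-or : ∀ {m Δ} {φ ψ : Formula σ m Δ} → WF φ → WF ψ → WF (or φ ψ)
  wf-or a b = w-neg (w-and (w-neg a) (w-neg b))

  wf-imp : ∀ {m Δ} {φ ψ : Formula σ m Δ} → WF φ → WF ψ → WF (imp φ ψ)
  wf-imp a b = w-neg (w-and a (w-neg b))

  wf-exq : ∀ {m Δ} q {φ : Formula σ (q + m) Δ} → WF φ → WF (exq q φ)
  wf-exq zero    w = w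
  wf-exq (suc q) w = wf-exq q (w-ex w)

  wf-allq : ∀ {m Δ} q {φ : Formula σ (q + m) Δ} → WF φ → WF (allq q φ)
  wf-allq q w = w-neg (wf-exq q (w-neg w))

-- By induction on the stages, stage n lies inside R and
-- contains all elements of R of rank < n; if all ranks are below sizeᵏ,
-- the evaluated fixed point is exactly R.
module LFPCharacterisation {σ : Signature} (M : Structure σ) {m Δ} (k : ℕ)
  (ψ : Formula σ (k + m) (k ∷ Δ)) (ρ : Vec (Fin (size M)) m) (ε : Env Δ (size M))
  (R : Vec (Fin (size M)) k → Set) (rank : Vec (Fin (size M)) k → ℕ)
  (sound : ∀ (X : Vec (Fin (size M)) k → Bool) → (∀ u → T (X u) → R u) → ∀ t →
            T (eval M ψ (t ++ ρ) (envCons {Δ} {size M} {k} X ε)) → R t)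
  (complete : ∀ t → R t → ∀ (X : Vec (Fin (size M)) k → Bool) → (∀ u → R u → rank u < rank t → T (X u)) →
            T (eval M ψ (t ++ ρ) (envCons {Δ} {size M} {k} X ε)))
  where

  stage-sound : ∀ n t → T (stage M k ψ ρ ε n t) → R t
  stage-sound (suc n) t h with T∨-elim {stage M k ψ ρ ε n t} h
  ... | inj₁ x = stage-sound n t x
  ... | inj₂ y = sound (stage M k ψ ρ ε n) (stage-sound n) t y

  stage-complete : ∀ n t → R t → rank t < n → T (stage M k ψ ρ ε n t)
  stage-complete (suc n) t r (s≤s lt) =
    T∨-introʳ {stage M k ψ ρ ε n t}
      (complete t r (stage M k ψ ρ ε n) (λ u ru lu → stage-complete n u ru (<-≤-trans lu lt)))

  lfp-char : (∀ t → R t → rank t < size M ^ k) → ∀ t → Iff (T (stage M k ψ ρ ε (size M ^ k) t)) (R t)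
  lfp-char bound t = stage-sound (size M ^ k) t , (λ r → stage-complete (size M ^ k) t r (bound t r))

boolToℕ : Bool → ℕ
boolToℕ true  = 1
boolToℕ false = 0

sumFin : ∀ s → (Fin s → ℕ) → ℕ
sumFin zero    f = 0
sumFin (suc s) f = f zero + sumFin s (λ i → f (suc i))

sumFin-mono : ∀ s (f g : Fin s → ℕ) → (∀ i → f i ≤ g i) → sumFin s f ≤ sumFin s g
sumFin-mono zero    f g h = z≤n
sumFin-mono (suc s) f g h = +-mono-≤ (h zero) (sumFin-mono s _ _ (λ i → h (suc i)))

sumFin-strict : ∀ s (f g : Fin s → ℕ) → (∀ i → f i ≤ g i) → ∀ j → f j < g j → sumFin s f < sumFin s g
sumFin-strict (suc s) f g h zero    lt = +-mono-<-≤ lt (sumFin-mono s _ _ (λ i → h (suc i)))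
sumFin-strict (suc s) f g h (suc j) lt = +-mono-≤-< (h zero) (sumFin-strict s _ _ (λ i → h (suc i)) j lt)

sumFin-bound : ∀ s (f : Fin s → ℕ) B → (∀ i → f i ≤ B) → sumFin s f ≤ s * B
sumFin-bound zero    f B h = z≤n
sumFin-bound (suc s) f B h = +-mono-≤ (h zero) (sumFin-bound s _ B (λ i → h (suc i)))

maxFin : ∀ s → (Fin s → ℕ) → ℕ
maxFin zero    f = 0
maxFin (suc s) f = f zero ⊔ maxFin s (λ i → f (suc i))

maxFin-ub : ∀ s (f : Fin s → ℕ) i → f i ≤ maxFin s f
maxFin-ub (suc s) f zero    = m≤m⊔n _ _
maxFin-ub (suc s) f (suc i) = ≤-trans (maxFin-ub s _ i) (m≤n⊔m (f zero) _)

maxFin-lub : ∀ s (f : Fin s → ℕ) B → (∀ i → f i ≤ B) → maxFin s f ≤ B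
maxFin-lub zero    f B h = z≤n
maxFin-lub (suc s) f B h = ⊔-lub (h zero) (maxFin-lub s _ B (λ i → h (suc i)))

maxFin-attained : ∀ s (f : Fin s → ℕ) → maxFin s f ≡ 0 ⊎ ∃ λ i → maxFin s f ≡ f i
maxFin-attained zero    f = inj₁ refl
maxFin-attained (suc s) f with ⊔-sel (f zero) (maxFin s (λ i → f (suc i)))
... | inj₁ e = inj₂ (zero , e)
... | inj₂ e with maxFin-attained s (λ i → f (suc i))
...   | inj₁ z        = inj₁ (trans e z)
...   | inj₂ (i , e') = inj₂ (suc i , trans e e')

maxFin-cong : ∀ s (f g : Fin s → ℕ) → (∀ i → f i ≡ g i) → maxFin s f ≡ maxFin s g
maxFin-cong zero    f g h = refl
maxFin-cong (suc s) f g h = cong₂ _⊔_ (h zero) (maxFin-cong s _ _ (λ i → h (suc i)))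

module _ {s : ℕ} where
  count : ∀ n → (Vec (Fin s) n → Bool) → ℕ
  count zero    P = boolToℕ (P [])
  count (suc n) P = sumFin s (λ a → count n (λ v → P (a ∷ v)))

  boolToℕ-mono : ∀ {a b} → (T a → T b) → boolToℕ a ≤ boolToℕ b
  boolToℕ-mono {false}        h = z≤n
  boolToℕ-mono {true} {true}  h = ≤-refl
  boolToℕ-mono {true} {false} h = ⊥-elim (h _)

  count-mono : ∀ n (P Q : Vec (Fin s) n → Bool) → (∀ v → T (P v) → T (Q v)) → count n P ≤ count n Q
  count-mono zero    P Q h = boolToℕ-mono (h [])
  count-mono (suc n) P Q h = sumFin-mono s _ _ (λ a → count-mono n _ _ (λ v → h (a ∷ v)))

  count-strict : ∀ n (P Q : Vec (Fin s) n → Bool) → (∀ v → T (P v) → T (Q v)) →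
                 ∀ v → ¬ T (P v) → T (Q v) → count n P < count n Q
  count-strict zero P Q h [] np q with P [] | Q []
  ... | false | true  = s≤s z≤n
  ... | true  | _     = ⊥-elim (np _)
  ... | false | false = ⊥-elim q
  count-strict (suc n) P Q h (a ∷ v) np q =
    sumFin-strict s _ _ (λ b → count-mono n _ _ (λ w → h (b ∷ w))) a
      (count-strict n _ _ (λ w → h (a ∷ w)) v np q)

  count-bound : ∀ n (P : Vec (Fin s) n → Bool) → count n P ≤ s ^ n
  count-bound zero P with P []
  ... | true  = ≤-refl
  ... | false = z≤n
  count-bound (suc n) P = sumFin-bound s _ (s ^ n) (λ a → count-bound n _)

  maxVec : ∀ n → (Vec (Fin s) n → ℕ) → ℕ
  maxVec zero    g = g []
  maxVec (suc n) g = maxFin s (λ a → maxVec n (λ v → g (a ∷ v)))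

  maxVec-ub : ∀ n (g : Vec (Fin s) n → ℕ) v → g v ≤ maxVec n g
  maxVec-ub zero    g []      = ≤-refl
  maxVec-ub (suc n) g (a ∷ v) = ≤-trans (maxVec-ub n _ v) (maxFin-ub s _ a)

  maxVec-lub : ∀ n (g : Vec (Fin s) n → ℕ) B → (∀ v → g v ≤ B) → maxVec n g ≤ B
  maxVec-lub zero    g B h = h []
  maxVec-lub (suc n) g B h = maxFin-lub s _ B (λ a → maxVec-lub n _ B (λ v → h (a ∷ v)))

  maxVec-attained : ∀ n (g : Vec (Fin s) n → ℕ) → maxVec n g ≡ 0 ⊎ ∃ λ v → maxVec n g ≡ g v
  maxVec-attained zero    g = inj₂ ([] , refl)
  maxVec-attained (suc n) g with maxFin-attained s (λ a → maxVec n (λ v → g (a ∷ v)))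
  ... | inj₁ z       = inj₁ z
  ... | inj₂ (a , e) with maxVec-attained n (λ v → g (a ∷ v))
  ...   | inj₁ z        = inj₁ (trans e z)
  ...   | inj₂ (v , e') = inj₂ (a ∷ v , trans e e')

  maxVec-cong : ∀ n (g h : Vec (Fin s) n → ℕ) → (∀ v → g v ≡ h v) → maxVec n g ≡ maxVec n h
  maxVec-cong zero    g h e = e []
  maxVec-cong (suc n) g h e = maxFin-cong s _ _ (λ a → maxVec-cong n _ _ (λ v → e (a ∷ v)))

^-strict : ∀ s → 2 ≤ s → ∀ p k → suc p ≤ k → s ^ p < s ^ k
^-strict (suc zero) (s≤s ()) p k le
^-strict (suc (suc s')) _ p k le = <-≤-trans base (^-monoʳ-≤ (2 + s') le)
  where
  x : ℕ
  x = (2 + s') ^ p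
  base : x < (2 + s') * x
  base = subst (_< (2 + s') * x) (+-identityʳ x)
           (+-monoʳ-< x {0} (≤-trans (m^n>0 (2 + s') p) (m≤m+n x (s' * x))))

-- Digits m t y c₁ c₂ says that y = c₁ + m·(c₂ + t·w)
-- with c₁ < m and c₂ < t; that is, c₁ = y mod m and c₂ = ⌊y / m⌋ mod t.
-- When m = tⁱ, c₂ is the i-th digit of y in base t.
Digits : ℕ → ℕ → ℕ → ℕ → ℕ → Set
Digits m t y c₁ c₂ = ∃ λ w → y ≡ c₁ + m * (c₂ + t * w) × c₁ < m × c₂ < t

-- How the pair of digits changes from y to y + 1: either the low digit
-- increases, or it wraps around to 0 and the high digit increases or wraps.
Step : ℕ → ℕ → ℕ → ℕ → ℕ → ℕ → Set
Step d₁ d₂ c₁ c₂ m t =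
  (c₁ ≡ suc d₁ × c₁ < m × d₂ ≡ c₂) ⊎
  (c₁ ≡ 0 × m ≡ suc d₁ × ((c₂ ≡ suc d₂ × c₂ < t) ⊎ (c₂ ≡ 0 × t ≡ suc d₂)))

digits-cong : ∀ {m t y y' c₁ c₁' c₂ c₂'} → y ≡ y' → c₁ ≡ c₁' → c₂ ≡ c₂' →
              Digits m t y c₁ c₂ → Digits m t y' c₁' c₂'
digits-cong refl refl refl d = d

digits-zero : ∀ m t → 0 < m → 0 < t → Digits m t 0 0 0
digits-zero m t l₁ l₂ = 0 , sym (trans (cong (m *_) (*-zeroʳ t)) (*-zeroʳ m)) , l₁ , l₂

digits-step : ∀ m t y d₁ d₂ c₁ c₂ → Digits m t y d₁ d₂ → Step d₁ d₂ c₁ c₂ m t → Digits m t (suc y) c₁ c₂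
digits-step m t y d₁ d₂ c₁ c₂ (w , e , l₁ , l₂) (inj₁ (refl , lc , refl)) = w , cong suc e , lc , l₂
digits-step m t y d₁ d₂ c₁ c₂ (w , e , l₁ , l₂) (inj₂ (refl , refl , inj₁ (refl , lc))) =
  w , trans (cong suc e) (sym (*-suc (suc d₁) (d₂ + t * w))) , s≤s z≤n , lc
digits-step m t y d₁ d₂ c₁ c₂ (w , e , l₁ , l₂) (inj₂ (refl , refl , inj₂ (refl , refl))) =
  suc w , trans (cong suc e)
    (sym (trans (cong (suc d₁ *_) (*-suc (suc d₂) w)) (*-suc (suc d₁) (d₂ + suc d₂ * w)))) ,
  s≤s z≤n , s≤s z≤n

digits-pred : ∀ m t y c₁ c₂ → Digits m t y c₁ c₂ →
  (y ≡ 0 × c₁ ≡ 0 × c₂ ≡ 0) ⊎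
  (∃ λ y' → ∃ λ d₁ → ∃ λ d₂ → y ≡ suc y' × Digits m t y' d₁ d₂ × Step d₁ d₂ c₁ c₂ m t)
digits-pred m t y (suc c₁) c₂ (w , e , l₁ , l₂) =
  inj₂ (_ , c₁ , c₂ , e , (w , refl , <-trans (n<1+n c₁) l₁ , l₂) , inj₁ (refl , l₁ , refl))
digits-pred (suc m) t y zero (suc c₂) (w , e , l₁ , l₂) =
  inj₂ (_ , m , c₂ , trans e (*-suc (suc m) (c₂ + t * w)) , (w , refl , n<1+n m , <-trans (n<1+n c₂) l₂) ,
        inj₂ (refl , refl , inj₁ (refl , l₂)))
digits-pred (suc m) (suc t) y zero zero (zero , e , l₁ , l₂) =
  inj₁ (trans e (trans (cong (suc m *_) (*-zeroʳ t)) (*-zeroʳ m)) , refl , refl)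
digits-pred (suc m) (suc t) y zero zero (suc w , e , l₁ , l₂) =
  inj₂ (_ , m , t , trans e (trans (cong (suc m *_) (*-suc (suc t) w)) (*-suc (suc m) (t + suc t * w))) ,
        (w , refl , n<1+n m , n<1+n t) , inj₂ (refl , refl , inj₂ (refl , refl)))

quotient-unique : ∀ m a a' x x' → a < m → a' < m → a + m * x ≡ a' + m * x' → x ≡ x'
quotient-unique m a a' zero    zero     l l' e = refl
quotient-unique m a a' zero    (suc x') l l' e = ⊥-elim (remainder-too-small m a a' x' l e)
  where
  remainder-too-small : ∀ m a a' y → a < m → a + m * 0 ≡ a' + m * suc y → ⊥
  remainder-too-small m a a' y l e = <⇒≱ l (begin
    m                 ≤⟨ m≤m+n m (a' + m * y) ⟩
    m + (a' + m * y)  ≡⟨ +-comm m _ ⟩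
    a' + m * y + m    ≡⟨ +-assoc a' _ m ⟩
    a' + (m * y + m)  ≡⟨ cong (a' +_) (sym (*-suc' m y)) ⟩
    a' + m * suc y    ≡⟨ sym e ⟩
    a + m * 0         ≡⟨ cong (a +_) (*-zeroʳ m) ⟩
    a + 0             ≡⟨ +-identityʳ a ⟩
    a                 ∎)
    where
    open ≤-Reasoning
    *-suc' : ∀ m y → m * suc y ≡ m * y + m
    *-suc' m y = trans (*-suc m y) (+-comm m (m * y))
quotient-unique m a a' (suc x) zero     l l' e = sym (quotient-unique m a' a zero (suc x) l' l (sym e))
quotient-unique m a a' (suc x) (suc x') l l' e = cong suc (quotient-unique m a a' x x' l l'
  (+-cancelˡ-≡ m _ _ (begin
    m + (a + m * x)   ≡⟨ +-swap m a _ ⟩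
    a + (m + m * x)   ≡⟨ cong (a +_) (sym (*-suc m x)) ⟩
    a + m * suc x     ≡⟨ e ⟩
    a' + m * suc x'   ≡⟨ cong (a' +_) (*-suc m x') ⟩
    a' + (m + m * x') ≡⟨ +-swap a' m _ ⟩
    m + (a' + m * x') ∎)))
  where
  open ≡-Reasoning
  +-swap : ∀ a b c → a + (b + c) ≡ b + (a + c)
  +-swap a b c = trans (sym (+-assoc a b c)) (trans (cong (_+ c) (+-comm a b)) (+-assoc b a c))

digit-unique : ∀ m t c₁ c₁' x x' w w' → c₁ + m * (x + t * w) ≡ c₁' + m * (x' + t * w') →
               c₁ < m → c₁' < m → x < t → x' < t → x ≡ x'
digit-unique m t c₁ c₁' x x' w w' e l₁ l₁' l₂ l₂' =
  +-cancelʳ-≡ (t * w) x x' (trans upper (cong (λ v → x' + t * v) (sym high)))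
  where
  upper : x + t * w ≡ x' + t * w'
  upper = quotient-unique m c₁ c₁' _ _ l₁ l₁' e
  high : w ≡ w'
  high = quotient-unique t x x' w w' l₂ l₂' upper

-- The number with base-t digits d 0, d 1, …, d (n-1) (least significant first).
value : ∀ t n → (Fin n → ℕ) → ℕ
value t zero    d = 0
value t (suc n) d = d zero + t * value t n (λ j → d (suc j))

digit-lt : ∀ t d L B → d < t → L < B → d + t * L < t * B
digit-lt t d L B l₁ l₂ = <-≤-trans (+-monoˡ-< (t * L) l₁) (subst (_≤ t * B) (*-suc t L) (*-monoʳ-≤ t l₂))

value-lt : ∀ t n (d : Fin n → ℕ) → (∀ j → d j < t) → value t n d < t ^ n
value-lt t zero    d h = s≤s z≤n
value-lt t (suc n) d h = digit-lt t (d zero) _ (t ^ n) (h zero) (value-lt t n _ (λ j → h (suc j)))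

value-digits : ∀ t n (d : Fin n → ℕ) → (∀ j → d j < t) → ∀ i →
  ∃ λ low → ∃ λ high → value t n d ≡ low + t ^ toℕ i * (d i + t * high) × low < t ^ toℕ i
value-digits t (suc n) d h zero = 0 , value t n (λ j → d (suc j)) , sym (+-identityʳ _) , s≤s z≤n
value-digits t (suc n) d h (suc i) with value-digits t n (λ j → d (suc j)) (λ j → h (suc j)) i
... | low , high , e , l = d zero + t * low , high , eqv , digit-lt t (d zero) low (t ^ toℕ i) (h zero) l
  where
  open ≡-Reasoning
  X : ℕ
  X = d (suc i) + t * high
  eqv : d zero + t * value t n (λ j → d (suc j)) ≡ (d zero + t * low) + t * t ^ toℕ i * X
  eqv = begin
    d zero + t * value t n (λ j → d (suc j)) ≡⟨ cong (λ v → d zero + t * v) e ⟩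
    d zero + t * (low + t ^ toℕ i * X)       ≡⟨ cong (d zero +_) (*-distribˡ-+ t low (t ^ toℕ i * X)) ⟩
    d zero + (t * low + t * (t ^ toℕ i * X)) ≡⟨ sym (+-assoc (d zero) (t * low) _) ⟩
    d zero + t * low + t * (t ^ toℕ i * X)   ≡⟨ cong ((d zero + t * low) +_) (sym (*-assoc t (t ^ toℕ i) X)) ⟩
    d zero + t * low + t * t ^ toℕ i * X     ∎

-- Sub(c, b) is the first-order formula φ(M^x; c) ⊊ φ(M^x; b).  The height of
-- b is the length of the longest ⊊-chain of parameters ending in b.  Since
-- ⊊ strictly increases the number of solutions, heights are bounded by
-- sizeᵖ, and every number below the height of b is itself a height.
module StrictInclusion {σ : Signature} (p q : ℕ) (φ : Formula σ (p + q) []) where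

  -- In scope p + (q + q) = (a, c, b): the tuples a ++ c and a ++ b.
  vars-ac vars-ab : Vec (Fin (p + (q + q))) (p + q)
  vars-ac = first p ++ under p (first q)
  vars-ab = first p ++ under p (under q (allFin q))

  Sub : Formula σ (q + q) []
  Sub = and (allq p (imp (inst φ vars-ac) (inst φ vars-ab)))
            (exq p (and (neg (inst φ vars-ac)) (inst φ vars-ab)))

  wf-Sub : WF φ → WF Sub
  wf-Sub wfφ = w-and (wf-allq p (wf-imp (wf-inst φ vars-ac wfφ) (wf-inst φ vars-ab wfφ)))
                     (wf-exq p (w-and (w-neg (wf-inst φ vars-ac wfφ)) (wf-inst φ vars-ab wfφ)))

  module Heights (M : Structure σ) where
    open EvalLemmas M public
    open ConnectiveSemantics M public

    s : ℕ
    s = size M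

    e₀ : Env [] s
    e₀ = ε₀ {σ} {s}

    ev : ∀ {n} → Formula σ n [] → Vec S n → Bool
    ev ψ v = eval M ψ v e₀

    inst-val : ∀ {n m} Δ (ψ : Formula σ n []) (vs : Vec (Fin m) n) (ρ : Vec S m) (ε : Env Δ s) {w} →
               ⟦ vs ⟧ ρ ≡ w → eval M (inst {Δ = Δ} ψ vs) ρ ε ≡ ev ψ w
    inst-val Δ ψ vs ρ ε e = trans (inst-sem Δ ψ vs ρ ε) (cong (ev ψ) e)

    Tup : Set
    Tup = Vec S q

    sat : Vec S p → Tup → Bool
    sat a b = ev φ (a ++ b)

    SubSet : Tup → Tup → Set
    SubSet c b = (∀ a → T (sat a c) → T (sat a b)) × (∃ λ a → ¬ T (sat a c) × T (sat a b))

    sub : Tup → Tup → Bool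
    sub c b = ev Sub (c ++ b)

    ⟦vars-ac⟧ : ∀ (a : Vec S p) (c b : Tup) → ⟦ vars-ac ⟧ (a ++ (c ++ b)) ≡ a ++ c
    ⟦vars-ac⟧ a c b = ⟦++⟧ (first p) (under p (first q)) (a ++ (c ++ b)) (⟦first⟧ a (c ++ b))
                        (trans (⟦under⟧ a (c ++ b) (first q)) (⟦first⟧ c b))

    ⟦vars-ab⟧ : ∀ (a : Vec S p) (c b : Tup) → ⟦ vars-ab ⟧ (a ++ (c ++ b)) ≡ a ++ b
    ⟦vars-ab⟧ a c b = ⟦++⟧ (first p) (under p (under q (allFin q))) (a ++ (c ++ b)) (⟦first⟧ a (c ++ b))
                        (trans (⟦under⟧ a (c ++ b) (under q (allFin q))) (trans (⟦under⟧ c b (allFin q)) (⟦all⟧ b)))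

    Sub-sem : ∀ c b → Iff (T (sub c b)) (SubSet c b)
    Sub-sem c b = to , from
      where
      Incl Witness : Formula σ (q + q) []
      Incl    = allq p (imp (inst φ vars-ac) (inst φ vars-ab))
      Witness = exq p (and (neg (inst φ vars-ac)) (inst φ vars-ab))
      φc : ∀ a → eval M (inst φ vars-ac) (a ++ (c ++ b)) e₀ ≡ sat a c
      φc a = inst-val [] φ vars-ac _ e₀ (⟦vars-ac⟧ a c b)
      φb : ∀ a → eval M (inst φ vars-ab) (a ++ (c ++ b)) e₀ ≡ sat a b
      φb a = inst-val [] φ vars-ab _ e₀ (⟦vars-ab⟧ a c b)
      to : T (sub c b) → SubSet c b
      to h = let (h₁ , h₂) = T∧-elim {eval M Incl (c ++ b) e₀} h in
        (λ a sc → T-to (φb a) (imp-elim [] (inst φ vars-ac) (inst φ vars-ab) _ e₀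
                                 (allq-elim [] p _ (c ++ b) e₀ h₁ a) (T-from (φc a) sc))) ,
        (let (a , u) = exq-elim [] p _ (c ++ b) e₀ h₂
             (u₁ , u₂) = T∧-elim {eval M (neg (inst φ vars-ac)) (a ++ (c ++ b)) e₀} u in
         a , (λ sc → T-not-elim u₁ (T-from (φc a) sc)) , T-to (φb a) u₂)
      from : SubSet c b → T (sub c b)
      from (f , (a , n , y)) = T∧-intro {eval M Incl (c ++ b) e₀}
        (allq-intro [] p _ (c ++ b) e₀ (λ a' → imp-intro [] (inst φ vars-ac) (inst φ vars-ab) _ e₀
           (λ h → T-from (φb a') (f a' (T-to (φc a') h)))))
        (exq-intro [] p _ (c ++ b) e₀ a (T∧-intro {eval M (neg (inst φ vars-ac)) (a ++ (c ++ b)) e₀}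
           (T-not-intro (λ h → n (T-to (φc a) h))) (T-from (φb a) y)))

    card : Tup → ℕ
    card b = count {s} p (λ a → sat a b)

    card-sub : ∀ c b → T (sub c b) → card c < card b
    card-sub c b h = let (f , (a , n , y)) = proj₁ (Sub-sem c b) h in
      count-strict p (λ a → sat a c) (λ a → sat a b) f a n y

    card-bound : ∀ b → card b ≤ s ^ p
    card-bound b = count-bound p _

    -- heightWithin f b: longest chain ending in b, searching f levels deep.
    heightWithin : ℕ → Tup → ℕ
    heightWithin zero    b = 0
    heightWithin (suc f) b = maxVec {s} q (λ c → if sub c b then suc (heightWithin f c) else 0)

    heightWithin≤card : ∀ f b → heightWithin f b ≤ card b
    heightWithin≤card zero    b = z≤n
    heightWithin≤card (suc f) b = maxVec-lub q _ (card b) bound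
      where
      bound : ∀ c → (if sub c b then suc (heightWithin f c) else 0) ≤ card b
      bound c with sub c b in e
      ... | true  = ≤-trans (s≤s (heightWithin≤card f c)) (card-sub c b (subst T (sym e) _))
      ... | false = z≤n

    -- A search deeper than card b finds nothing new, since chains below b
    -- have length at most card b.
    heightWithin-stable : ∀ f b → card b < f → heightWithin (suc f) b ≡ heightWithin f b
    heightWithin-stable (suc f) b (s≤s lt) = maxVec-cong q _ _ same
      where
      same : ∀ c → (if sub c b then suc (heightWithin (suc f) c) else 0)
                 ≡ (if sub c b then suc (heightWithin f c) else 0)
      same c with sub c b in e
      ... | true  = cong suc (heightWithin-stable f c (<-≤-trans (card-sub c b (subst T (sym e) _)) lt))
      ... | false = refl

    heightWithin-settled : ∀ f b → card b < f → heightWithin f b ≡ heightWithin (suc (card b)) b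
    heightWithin-settled (suc f) b (s≤s lt) with m≤n⇒m<n∨m≡n lt
    ... | inj₁ l    = trans (heightWithin-stable f b l) (heightWithin-settled f b l)
    ... | inj₂ refl = refl

    height : Tup → ℕ
    height b = heightWithin (suc (s ^ p)) b

    height-within : ∀ f b → card b < f → heightWithin f b ≡ height b
    height-within f b lt = trans (heightWithin-settled f b lt) (sym (heightWithin-settled (suc (s ^ p)) b (s≤s (card-bound b))))

    height-bound : ∀ b → height b ≤ s ^ p
    height-bound b = ≤-trans (heightWithin≤card (suc (s ^ p)) b) (card-bound b)

    height-sub : ∀ c b → T (sub c b) → height c < height b
    height-sub c b h = begin-strict
      height c                                                  ≡⟨ sym (height-within (s ^ p) c card-c) ⟩
      heightWithin (s ^ p) c                                    <⟨ n<1+n _ ⟩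
      suc (heightWithin (s ^ p) c)                              ≡⟨ sym (sub-true c h) ⟩
      (if sub c b then suc (heightWithin (s ^ p) c) else 0)     ≤⟨ maxVec-ub q _ c ⟩
      height b                                                  ∎
      where
      open ≤-Reasoning
      card-c : card c < s ^ p
      card-c = ≤-trans (card-sub c b h) (card-bound b)
      sub-true : ∀ c' → T (sub c' b) → (if sub c' b then suc (heightWithin (s ^ p) c') else 0)
                                      ≡ suc (heightWithin (s ^ p) c')
      sub-true c' h' with sub c' b
      ... | true = refl

    height-pred : ∀ b h → height b ≡ suc h → ∃ λ c → T (sub c b) × height c ≡ h
    height-pred b h e with maxVec-attained {s} q (λ c → if sub c b then suc (heightWithin (s ^ p) c) else 0)
    ... | inj₁ z       = ⊥-elim (0≢1+n (trans (sym z) e))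
    ... | inj₂ (c , e') = witness (trans (sym e') e)
      where
      witness : (if sub c b then suc (heightWithin (s ^ p) c) else 0) ≡ suc h → ∃ λ c → T (sub c b) × height c ≡ h
      witness e'' with sub c b in es
      ... | true  = c , subst T (sym es) _ ,
                    trans (sym (height-within (s ^ p) c (≤-trans (card-sub c b (subst T (sym es) _)) (card-bound b))))
                          (suc-injective e'')
      ... | false = ⊥-elim (0≢1+n e'')

    height-realised : ∀ b v → v ≤ height b → ∃ λ c → height c ≡ v
    height-realised b v le = let (d , e) = m≤n⇒∃[o]m+o≡n le in descend d b (sym e)
      where
      descend : ∀ d b → height b ≡ v + d → ∃ λ c → height c ≡ v
      descend zero    b e = b , trans e (+-identityʳ v)
      descend (suc d) b e with height-pred b (v + d) (trans e (+-suc v d))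
      ... | c , _ , e' = descend d c e'

-- Le(b, b') says height b ≤ height b'.  It is the least fixed point of
--   S(b, b', z) ← ∀c (c ⊊ b → ∃c' (c' ⊊ b' ∧ S(c, c', z)))
-- (inductively: every chain below b is matched by one below b').  The
-- dummy tuple z of length p + 1 only raises the arity K so that sizeᴷ
-- exceeds every height, i.e. the evaluated stages reach the fixed point.
module HeightComparison {σ : Signature} (p q : ℕ) (φ : Formula σ (p + q) []) where
  open StrictInclusion p q φ public

  P : ℕ
  P = suc p

  -- Le: fixed-point variables (b, b', z), outer scope (z, b, b') after ∃z.
  K : ℕ
  K = q + (q + P)

  outerLe : ℕ
  outerLe = P + (q + q)

  -- In scope c ++ (b, b', z) ++ outer, and c' ++ c ++ (b, b', z) ++ outer.
  vars-cb : Vec (Fin (q + (K + outerLe))) (q + q)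
  vars-cb = first q ++ under q (front outerLe (first q))

  vars-c'b' : Vec (Fin (q + (q + (K + outerLe)))) (q + q)
  vars-c'b' = first q ++ under q (under q (front outerLe (under q (first q))))

  vars-cc'z : Vec (Fin (q + (q + (K + outerLe)))) K
  vars-cc'z = under q (first q) ++ (first q ++ under q (under q (front outerLe (under q (under q (allFin P))))))

  LeBody : Formula σ (K + outerLe) (K ∷ [])
  LeBody = allq q (imp (inst Sub vars-cb) (exq q (and (inst Sub vars-c'b') (rvar zero vars-cc'z))))

  LeArgs : Vec (Fin outerLe) K
  LeArgs = under P (first q) ++ (under P (under q (allFin q)) ++ first P)

  Le : Formula σ (q + q) []
  Le = exq P (lfp K LeBody LeArgs)

  vars-bb' vars-b'b : Vec (Fin (q + q)) (q + q)
  vars-bb' = first q ++ under q (allFin q)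
  vars-b'b = under q (allFin q) ++ first q

  Equal : Formula σ (q + q) []
  Equal = and (inst Le vars-bb') (inst Le vars-b'b)

  Less : Formula σ (q + q) []
  Less = neg (inst Le vars-b'b)

  IsZero : Formula σ q []
  IsZero = allq q (inst Le vars-b'b)

  -- In scope c ++ (b, b'): the pairs (b, c) and (c, b').
  vars-bc vars-cb' : Vec (Fin (q + (q + q))) (q + q)
  vars-bc  = under q (first q) ++ first q
  vars-cb' = first q ++ under q (under q (allFin q))

  IsSucc : Formula σ (q + q) []
  IsSucc = and (inst Less vars-bb') (neg (exq q (and (inst Less vars-bc) (inst Less vars-cb'))))

  module _ (wfφ : WF φ) where
    wf-Le : WF Le
    wf-Le = wf-exq P (w-lfp
      (pos-allq q (pos-imp (proj₂ (both-inst Sub vars-cb zero))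
                           (pos-exq q (p-and (proj₁ (both-inst Sub vars-c'b' zero)) p-rvar))))
      (wf-allq q (wf-imp (wf-inst Sub vars-cb (wf-Sub wfφ))
                         (wf-exq q (w-and (wf-inst Sub vars-c'b' (wf-Sub wfφ)) w-rvar)))))

    wf-Equal : WF Equal
    wf-Equal = w-and (wf-inst Le vars-bb' wf-Le) (wf-inst Le vars-b'b wf-Le)

    wf-Less : WF Less
    wf-Less = w-neg (wf-inst Le vars-b'b wf-Le)

    wf-IsZero : WF IsZero
    wf-IsZero = wf-allq q (wf-inst Le vars-b'b wf-Le)

    wf-IsSucc : WF IsSucc
    wf-IsSucc = w-and (wf-inst Less vars-bb' wf-Less)
                      (w-neg (wf-exq q (w-and (wf-inst Less vars-bc wf-Less) (wf-inst Less vars-cb' wf-Less))))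

  module LeSemantics (M : Structure σ) (two≤size : 2 ≤ size M) where
    open Heights M public

    -- An element, to fill the dummy tuple z.
    elem : S
    elem = fromℕ< two≤size

    height<s^ : ∀ k → P ≤ k → ∀ b → height b < s ^ k
    height<s^ k le b = ≤-<-trans (height-bound b) (^-strict s two≤size p k le)

    module LeBodySemantics (b b' : Tup) (z : Vec S P) (ρ₀ : Vec S outerLe) (X : Vec S K → Bool) where
      t : Vec S K
      t = b ++ (b' ++ z)

      ρt : Vec S (K + outerLe)
      ρt = t ++ ρ₀

      E : Env (K ∷ []) s
      E = envCons {[]} {s} {K} X e₀

      ⟦vars-cb⟧ : ∀ c → ⟦ vars-cb ⟧ (c ++ ρt) ≡ c ++ b
      ⟦vars-cb⟧ c = ⟦++⟧ (first q) (under q (front outerLe (first q))) (c ++ ρt) (⟦first⟧ c ρt)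
        (trans (⟦under⟧ c ρt _) (trans (⟦front⟧ t ρ₀ (first q)) (⟦first⟧ b (b' ++ z))))

      ⟦vars-c'b'⟧ : ∀ c' c → ⟦ vars-c'b' ⟧ (c' ++ (c ++ ρt)) ≡ c' ++ b'
      ⟦vars-c'b'⟧ c' c = ⟦++⟧ (first q) (under q (under q (front outerLe (under q (first q))))) (c' ++ (c ++ ρt))
        (⟦first⟧ c' (c ++ ρt))
        (trans (⟦under⟧ c' (c ++ ρt) _) (trans (⟦under⟧ c ρt _)
          (trans (⟦front⟧ t ρ₀ (under q (first q))) (trans (⟦under⟧ b (b' ++ z) (first q)) (⟦first⟧ b' z)))))

      ⟦vars-cc'z⟧ : ∀ c' c → ⟦ vars-cc'z ⟧ (c' ++ (c ++ ρt)) ≡ c ++ (c' ++ z)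
      ⟦vars-cc'z⟧ c' c = ⟦++⟧ (under q (first q)) _ (c' ++ (c ++ ρt))
        (trans (⟦under⟧ c' (c ++ ρt) (first q)) (⟦first⟧ c ρt))
        (⟦++⟧ (first q) _ (c' ++ (c ++ ρt)) (⟦first⟧ c' (c ++ ρt))
          (trans (⟦under⟧ c' (c ++ ρt) _) (trans (⟦under⟧ c ρt _)
            (trans (⟦front⟧ t ρ₀ (under q (under q (allFin P))))
              (trans (⟦under⟧ b (b' ++ z) (under q (allFin P)))
                (trans (⟦under⟧ b' z (allFin P)) (⟦all⟧ z)))))))

      Matched : Set
      Matched = ∀ c → T (sub c b) → ∃ λ c' → T (sub c' b') × T (X (c ++ (c' ++ z)))

      sem : Iff (T (eval M LeBody ρt E)) Matched
      sem = to , from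
        where
        Rest : Formula σ (q + (q + (K + outerLe))) (K ∷ [])
        Rest = and (inst Sub vars-c'b') (rvar zero vars-cc'z)
        to : T (eval M LeBody ρt E) → Matched
        to h c sc =
          let h₁ = imp-elim (K ∷ []) (inst Sub vars-cb) (exq q Rest) (c ++ ρt) E
                     (allq-elim (K ∷ []) q _ ρt E h c) (T-from (inst-val (K ∷ []) Sub vars-cb (c ++ ρt) E (⟦vars-cb⟧ c)) sc)
              (c' , h₂) = exq-elim (K ∷ []) q Rest (c ++ ρt) E h₁
              (u₁ , u₂) = T∧-elim {eval M (inst Sub vars-c'b') (c' ++ (c ++ ρt)) E} h₂
          in c' , T-to (inst-val (K ∷ []) Sub vars-c'b' (c' ++ (c ++ ρt)) E (⟦vars-c'b'⟧ c' c)) u₁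
                , T-to (cong X (⟦vars-cc'z⟧ c' c)) u₂
        from : Matched → T (eval M LeBody ρt E)
        from F = allq-intro (K ∷ []) q _ ρt E (λ c → imp-intro (K ∷ []) (inst Sub vars-cb) (exq q Rest) (c ++ ρt) E (λ ha →
          let (c' , s₁ , x₁) = F c (T-to (inst-val (K ∷ []) Sub vars-cb (c ++ ρt) E (⟦vars-cb⟧ c)) ha)
          in exq-intro (K ∷ []) q Rest (c ++ ρt) E c'
               (T∧-intro {eval M (inst Sub vars-c'b') (c' ++ (c ++ ρt)) E}
                  (T-from (inst-val (K ∷ []) Sub vars-c'b' (c' ++ (c ++ ρt)) E (⟦vars-c'b'⟧ c' c)) s₁)
                  (T-from (cong X (⟦vars-cc'z⟧ c' c)) x₁))))

    HeightLe : Vec S K → Set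
    HeightLe t = height (take q t) ≤ height (take q (drop q t))

    rankLe : Vec S K → ℕ
    rankLe t = height (take q t)

    HeightLe-intro : ∀ b b' (z : Vec S P) → height b ≤ height b' → HeightLe (b ++ (b' ++ z))
    HeightLe-intro b b' z = subst₂ _≤_ (cong height (sym (take-++ b (b' ++ z))))
                                       (cong height (sym (take-drop-++ b b' z)))

    HeightLe-elim : ∀ b b' (z : Vec S P) → HeightLe (b ++ (b' ++ z)) → height b ≤ height b'
    HeightLe-elim b b' z = subst₂ _≤_ (cong height (take-++ b (b' ++ z)))
                                      (cong height (take-drop-++ b b' z))

    rankLe-++ : ∀ b (w : Vec S (q + P)) → rankLe (b ++ w) ≡ height b
    rankLe-++ b w = cong height (take-++ b w)

    -- Soundness: if height b > 0, match a predecessor c of height b - 1.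
    LeBody-sound : ∀ ρ₀ (X : Vec S K → Bool) → (∀ u → T (X u) → HeightLe u) → ∀ t →
                   T (eval M LeBody (t ++ ρ₀) (envCons {[]} {s} {K} X e₀)) → HeightLe t
    LeBody-sound ρ₀ X hX t h with split q (q + P) t
    ... | split-as b w with split q P w
    ...   | split-as b' z = HeightLe-intro b b' z (by-height (height b) refl)
      where
      matched : LeBodySemantics.Matched b b' z ρ₀ X
      matched = proj₁ (LeBodySemantics.sem b b' z ρ₀ X) h
      by-height : ∀ n → height b ≡ n → height b ≤ height b'
      by-height zero    e = subst (_≤ height b') (sym e) z≤n
      by-height (suc n) e =
        let (c , sc , hc) = height-pred b n e
            (c' , sc' , xc) = matched c sc
            le = HeightLe-elim c c' z (hX _ xc)
        in subst (_≤ height b') (sym e) (≤-trans (s≤s (subst (_≤ height c') hc le)) (height-sub c' b' sc'))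

    -- Completeness: a c ⊊ b has height below that of b', so some c' ⊊ b'
    -- of height one less than b' dominates it.
    LeBody-complete : ∀ ρ₀ t → HeightLe t → ∀ (X : Vec S K → Bool) →
                      (∀ u → HeightLe u → rankLe u < rankLe t → T (X u)) →
                      T (eval M LeBody (t ++ ρ₀) (envCons {[]} {s} {K} X e₀))
    LeBody-complete ρ₀ t r X hX with split q (q + P) t
    ... | split-as b w with split q P w
    ...   | split-as b' z = proj₂ (LeBodySemantics.sem b b' z ρ₀ X) matched
      where
      b≤b' : height b ≤ height b'
      b≤b' = HeightLe-elim b b' z r
      matched : LeBodySemantics.Matched b b' z ρ₀ X
      matched c sc = by-height (height b') refl
        where
        c<b' : height c < height b'
        c<b' = <-≤-trans (height-sub c b sc) b≤b'
        by-height : ∀ n → height b' ≡ n → ∃ λ c' → T (sub c' b') × T (X (c ++ (c' ++ z)))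
        by-height zero    e = ⊥-elim (<⇒≱ c<b' (subst (_≤ height c) (sym e) z≤n))
        by-height (suc n) e =
          let (c' , sc' , hc') = height-pred b' n e
              c≤c' = subst (height c ≤_) (sym hc') (≤-pred (subst (height c <_) e c<b'))
          in c' , sc' , hX _ (HeightLe-intro c c' z c≤c')
                             (subst₂ _<_ (sym (rankLe-++ c (c' ++ z))) (sym (rankLe-++ b (b' ++ z))) (height-sub c b sc))

    P≤K : P ≤ K
    P≤K = subst (P ≤_) (+-assoc q q P) (m≤n+m P (q + q))

    ⟦LeArgs⟧ : ∀ b b' (z : Vec S P) → ⟦ LeArgs ⟧ (z ++ (b ++ b')) ≡ b ++ (b' ++ z)
    ⟦LeArgs⟧ b b' z = ⟦++⟧ (under P (first q)) _ (z ++ (b ++ b'))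
      (trans (⟦under⟧ z (b ++ b') (first q)) (⟦first⟧ b b'))
      (⟦++⟧ (under P (under q (allFin q))) (first P) (z ++ (b ++ b'))
        (trans (⟦under⟧ z (b ++ b') (under q (allFin q))) (trans (⟦under⟧ b b' (allFin q)) (⟦all⟧ b')))
        (⟦first⟧ z (b ++ b')))

    Le-sem : ∀ b b' → Iff (T (ev Le (b ++ b'))) (height b ≤ height b')
    Le-sem b b' = to , from
      where
      lfpLe : ∀ (z : Vec S P) → Vec S K → Bool
      lfpLe z = stage M K LeBody (z ++ (b ++ b')) e₀ (s ^ K)
      char : ∀ (z : Vec S P) t → Iff (T (lfpLe z t)) (HeightLe t)
      char z = LFPCharacterisation.lfp-char M K LeBody (z ++ (b ++ b')) e₀ HeightLe rankLe
                 (LeBody-sound (z ++ (b ++ b'))) (LeBody-complete (z ++ (b ++ b')))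
                 (λ t _ → height<s^ K P≤K (take q t))
      to : T (ev Le (b ++ b')) → height b ≤ height b'
      to h = let (z , h') = exq-elim [] P (lfp K LeBody LeArgs) (b ++ b') e₀ h in
        HeightLe-elim b b' z
          (proj₁ (char z (b ++ (b' ++ z))) (T-to (cong (lfpLe z) (⟦LeArgs⟧ b b' z)) h'))
      from : height b ≤ height b' → T (ev Le (b ++ b'))
      from le = let z = replicate P elem in
        exq-intro [] P (lfp K LeBody LeArgs) (b ++ b') e₀ z
          (T-from (cong (lfpLe z) (⟦LeArgs⟧ b b' z))
              (proj₂ (char z (b ++ (b' ++ z))) (HeightLe-intro b b' z le)))

module OrderSemantics {σ : Signature} (p q : ℕ) (φ : Formula σ (p + q) [])
                      (M : Structure σ) (two≤size : 2 ≤ size M) where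
  open HeightComparison p q φ public
  open LeSemantics M two≤size public

  ⟦vars-bb'⟧ : ∀ (b b' : Tup) → ⟦ vars-bb' ⟧ (b ++ b') ≡ b ++ b'
  ⟦vars-bb'⟧ b b' = ⟦++⟧ (first q) (under q (allFin q)) (b ++ b')
                      (⟦first⟧ b b') (trans (⟦under⟧ b b' (allFin q)) (⟦all⟧ b'))

  ⟦vars-b'b⟧ : ∀ (b b' : Tup) → ⟦ vars-b'b ⟧ (b ++ b') ≡ b' ++ b
  ⟦vars-b'b⟧ b b' = ⟦++⟧ (under q (allFin q)) (first q) (b ++ b')
                      (trans (⟦under⟧ b b' (allFin q)) (⟦all⟧ b')) (⟦first⟧ b b')

  Le-swapped : ∀ b b' → eval M (inst Le vars-b'b) (b ++ b') e₀ ≡ ev Le (b' ++ b)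
  Le-swapped b b' = inst-val [] Le vars-b'b (b ++ b') e₀ (⟦vars-b'b⟧ b b')

  Equal-sem : ∀ b b' → Iff (T (ev Equal (b ++ b'))) (height b ≡ height b')
  Equal-sem b b' = to , from
    where
    Le-inorder : eval M (inst Le vars-bb') (b ++ b') e₀ ≡ ev Le (b ++ b')
    Le-inorder = inst-val [] Le vars-bb' (b ++ b') e₀ (⟦vars-bb'⟧ b b')
    to : T (ev Equal (b ++ b')) → height b ≡ height b'
    to h = let (h₁ , h₂) = T∧-elim {eval M (inst Le vars-bb') (b ++ b') e₀} h in
      ≤-antisym (proj₁ (Le-sem b b') (T-to Le-inorder h₁)) (proj₁ (Le-sem b' b) (T-to (Le-swapped b b') h₂))
    from : height b ≡ height b' → T (ev Equal (b ++ b'))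
    from e = T∧-intro {eval M (inst Le vars-bb') (b ++ b') e₀}
      (T-from Le-inorder (proj₂ (Le-sem b b') (≤-reflexive e)))
      (T-from (Le-swapped b b') (proj₂ (Le-sem b' b) (≤-reflexive (sym e))))

  Less-sem : ∀ b b' → Iff (T (ev Less (b ++ b'))) (height b < height b')
  Less-sem b b' = to , from
    where
    to : T (ev Less (b ++ b')) → height b < height b'
    to h = ≰⇒> (λ le → T-not-elim h (T-from (Le-swapped b b') (proj₂ (Le-sem b' b) le)))
    from : height b < height b' → T (ev Less (b ++ b'))
    from lt = T-not-intro (λ h → <⇒≱ lt (proj₁ (Le-sem b' b) (T-to (Le-swapped b b') h)))

  -- Height 0 is the least height, and it is attained below every b.
  IsZero-sem : ∀ b → Iff (T (ev IsZero b)) (height b ≡ 0)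
  IsZero-sem b = to , from
    where
    to : T (ev IsZero b) → height b ≡ 0
    to h = let (c , hc) = height-realised b 0 z≤n
               le = proj₁ (Le-sem b c) (T-to (Le-swapped c b) (allq-elim [] q (inst Le vars-b'b) b e₀ h c))
           in n≤0⇒n≡0 (subst (height b ≤_) hc le)
    from : height b ≡ 0 → T (ev IsZero b)
    from e = allq-intro [] q (inst Le vars-b'b) b e₀ (λ c →
      T-from (Le-swapped c b) (proj₂ (Le-sem b c) (subst (_≤ height c) (sym e) z≤n)))

  ⟦vars-bc⟧ : ∀ (c b b' : Tup) → ⟦ vars-bc ⟧ (c ++ (b ++ b')) ≡ b ++ c
  ⟦vars-bc⟧ c b b' = ⟦++⟧ (under q (first q)) (first q) (c ++ (b ++ b'))
    (trans (⟦under⟧ c (b ++ b') (first q)) (⟦first⟧ b b')) (⟦first⟧ c (b ++ b'))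

  ⟦vars-cb'⟧ : ∀ (c b b' : Tup) → ⟦ vars-cb' ⟧ (c ++ (b ++ b')) ≡ c ++ b'
  ⟦vars-cb'⟧ c b b' = ⟦++⟧ (first q) (under q (under q (allFin q))) (c ++ (b ++ b')) (⟦first⟧ c (b ++ b'))
    (trans (⟦under⟧ c (b ++ b') (under q (allFin q))) (trans (⟦under⟧ b b' (allFin q)) (⟦all⟧ b')))

  -- Heights form an initial segment (height-realised), so "no height
  -- strictly in between" is the same as "exactly one more".
  IsSucc-sem : ∀ b b' → Iff (T (ev IsSucc (b ++ b'))) (height b' ≡ suc (height b))
  IsSucc-sem b b' = to , from
    where
    Between : Formula σ (q + (q + q)) []
    Between = and (inst Less vars-bc) (inst Less vars-cb')
    Less-inorder : eval M (inst Less vars-bb') (b ++ b') e₀ ≡ ev Less (b ++ b')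
    Less-inorder = inst-val [] Less vars-bb' (b ++ b') e₀ (⟦vars-bb'⟧ b b')
    Less-bc : ∀ c → eval M (inst Less vars-bc) (c ++ (b ++ b')) e₀ ≡ ev Less (b ++ c)
    Less-bc c = inst-val [] Less vars-bc (c ++ (b ++ b')) e₀ (⟦vars-bc⟧ c b b')
    Less-cb' : ∀ c → eval M (inst Less vars-cb') (c ++ (b ++ b')) e₀ ≡ ev Less (c ++ b')
    Less-cb' c = inst-val [] Less vars-cb' (c ++ (b ++ b')) e₀ (⟦vars-cb'⟧ c b b')
    nothing-between : T (eval M (neg (exq q Between)) (b ++ b') e₀) →
                      ∀ c → height b < height c → height c < height b' → ⊥
    nothing-between h c l₁ l₂ = T-not-elim h (exq-intro [] q Between (b ++ b') e₀ c
      (T∧-intro {eval M (inst Less vars-bc) (c ++ (b ++ b')) e₀}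
        (T-from (Less-bc c) (proj₂ (Less-sem b c) l₁)) (T-from (Less-cb' c) (proj₂ (Less-sem c b') l₂))))
    to : T (ev IsSucc (b ++ b')) → height b' ≡ suc (height b)
    to h with T∧-elim {eval M (inst Less vars-bb') (b ++ b') e₀} h
    ... | h₁ , h₂ with m≤n⇒m<n∨m≡n (proj₁ (Less-sem b b') (T-to Less-inorder h₁))
    ...   | inj₂ e  = sym e
    ...   | inj₁ lt = let (c , hc) = height-realised b' (suc (height b)) (<⇒≤ lt) in
            ⊥-elim (nothing-between h₂ c (subst (height b <_) (sym hc) ≤-refl) (subst (_< height b') (sym hc) lt))
    from : height b' ≡ suc (height b) → T (ev IsSucc (b ++ b'))
    from e = T∧-intro {eval M (inst Less vars-bb') (b ++ b') e₀}
      (T-from Less-inorder (proj₂ (Less-sem b b') (subst (height b <_) (sym e) ≤-refl)))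
      (T-not-intro (λ h → let (c , u) = exq-elim [] q Between (b ++ b') e₀ h
                              (u₁ , u₂) = T∧-elim {eval M (inst Less vars-bc) (c ++ (b ++ b')) e₀} u
                              l₁ = proj₁ (Less-sem b c) (T-to (Less-bc c) u₁)
                              l₂ = proj₁ (Less-sem c b') (T-to (Less-cb' c) u₂)
                          in <⇒≱ (subst (height c <_) e l₂) l₁))

-- For parameters m, t of positive height, the least fixed point of
--   S(y, c₁, c₂, z) ← (y, c₁, c₂ all of height 0)
--                   ∨ ∃y' d₁ d₂ (S(y', d₁, d₂, z) ∧ y = y' + 1 ∧ Step(d₁, d₂ ↦ c₁, c₂))
-- (all arithmetic on heights, Step as in the Digits section) consists of
-- the (y, c₁, c₂) with Digits (height m) (height t) (height y) c₁ c₂: it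
-- counts y upwards while maintaining y mod m and ⌊y / m⌋ mod t.  Then
--   Digit(y, m, t, r) := ∃c₂ ∃c₁ (∃z S(y, c₁, c₂, z) ∧ c₂ = r)
-- says that the digit of height y at weight height m in base height t is
-- height r.
module DigitCounter {σ : Signature} (p q : ℕ) (φ : Formula σ (p + q) []) where
  open HeightComparison p q φ

  -- Digit has arguments (y, m, t, r).
  D : ℕ
  D = q + (q + (q + q))

  -- The counter has fixed-point variables (y, c₁, c₂, z); its outer scope
  -- is (z, c₁, c₂, y, m, t, r) inside Digit.
  Kc : ℕ
  Kc = q + (q + (q + P))

  outerC : ℕ
  outerC = P + (q + (q + D))

  W : ℕ
  W = Kc + outerC

  mC tC : Vec (Fin outerC) q
  mC = under P (under q (under q (under q (first q))))
  tC = under P (under q (under q (under q (under q (first q)))))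

  vY vC₁ vC₂ vM vT : Vec (Fin W) q
  vY  = front outerC (first q)
  vC₁ = front outerC (under q (first q))
  vC₂ = front outerC (under q (under q (first q)))
  vM  = under Kc mC
  vT  = under Kc tC

  vZ : Vec (Fin W) P
  vZ = front outerC (under q (under q (under q (allFin P))))

  -- The inductive step quantifies the predecessor (y', d₁, d₂).
  Wstep : ℕ
  Wstep = q + (q + (q + W))

  under3 : ∀ {j} → Vec (Fin W) j → Vec (Fin Wstep) j
  under3 v = under q (under q (under q v))

  vY' vD₁ vD₂ : Vec (Fin Wstep) q
  vY' = first q
  vD₁ = under q (first q)
  vD₂ = under q (under q (first q))

  v-d₁c₁ v-c₁m v-d₂c₂ v-d₁m v-c₂t v-d₂t v-y'y : Vec (Fin Wstep) (q + q)
  v-d₁c₁ = vD₁ ++ under3 vC₁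
  v-c₁m  = under3 vC₁ ++ under3 vM
  v-d₂c₂ = vD₂ ++ under3 vC₂
  v-d₁m  = vD₁ ++ under3 vM
  v-c₂t  = under3 vC₂ ++ under3 vT
  v-d₂t  = vD₂ ++ under3 vT
  v-y'y  = vY' ++ under3 vY

  v-rec : Vec (Fin Wstep) Kc
  v-rec = vY' ++ (vD₁ ++ (vD₂ ++ under3 vZ))

  Base : Formula σ W (Kc ∷ [])
  Base = and (inst IsZero vY) (and (inst IsZero vC₁) (inst IsZero vC₂))

  LowUp HighUp HighWrap : Formula σ Wstep (Kc ∷ [])
  LowUp    = and (inst IsSucc v-d₁c₁) (and (inst Less v-c₁m) (inst Equal v-d₂c₂))
  HighUp   = and (inst IsSucc v-d₂c₂) (inst Less v-c₂t)
  HighWrap = and (inst IsZero (under3 vC₂)) (inst IsSucc v-d₂t)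

  StepF : Formula σ Wstep (Kc ∷ [])
  StepF = or LowUp (and (inst IsZero (under3 vC₁)) (and (inst IsSucc v-d₁m) (or HighUp HighWrap)))

  Inductive : Formula σ Wstep (Kc ∷ [])
  Inductive = and (rvar zero v-rec) (and (inst IsSucc v-y'y) StepF)

  CounterBody : Formula σ W (Kc ∷ [])
  CounterBody = or Base (exq q (exq q (exq q Inductive)))

  CounterArgs : Vec (Fin outerC) Kc
  CounterArgs = under P (under q (under q (first q))) ++ (under P (first q) ++ (under P (under q (first q)) ++ first P))

  -- In scope (c₁, c₂, y, m, t, r): the pair (c₂, r).
  v-c₂r : Vec (Fin (q + (q + D))) (q + q)
  v-c₂r = under q (first q) ++ under q (under q (under q (under q (under q (allFin q)))))

  Counter∃ : Formula σ (q + (q + D)) []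
  Counter∃ = exq P (lfp Kc CounterBody CounterArgs)

  DigitMatrix : Formula σ (q + (q + D)) []
  DigitMatrix = and Counter∃ (inst Equal v-c₂r)

  Digit : Formula σ D []
  Digit = exq q (exq q DigitMatrix)

  wf-Digit : WF φ → WF Digit
  wf-Digit wfφ = wf-exq q (wf-exq q (w-and (wf-exq P (w-lfp positive wf-body)) (wf-inst Equal v-c₂r (wf-Equal wfφ))))
    where
    absent : ∀ {n m} (ψ : Formula σ n []) (vs : Vec (Fin m) n) → Both {Δ = Kc ∷ []} zero (inst ψ vs)
    absent ψ vs = both-inst ψ vs zero
    positive : Pos zero CounterBody
    positive = pos-or (proj₁ (both-and (absent IsZero vY) (both-and (absent IsZero vC₁) (absent IsZero vC₂))))
      (pos-exq q (pos-exq q (pos-exq q (p-and p-rvar (proj₁ (both-and (absent IsSucc v-y'y) (both-or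
        (both-and (absent IsSucc v-d₁c₁) (both-and (absent Less v-c₁m) (absent Equal v-d₂c₂)))
        (both-and (absent IsZero (under3 vC₁)) (both-and (absent IsSucc v-d₁m) (both-or
          (both-and (absent IsSucc v-d₂c₂) (absent Less v-c₂t))
          (both-and (absent IsZero (under3 vC₂)) (absent IsSucc v-d₂t))))))))))))
    wi : ∀ {n m} (ψ : Formula σ n []) (vs : Vec (Fin m) n) → WF ψ → WF {m = m} {Kc ∷ []} (inst ψ vs)
    wi ψ vs w = wf-inst ψ vs w
    wf-body : WF CounterBody
    wf-body = wf-or (w-and (wi IsZero vY (wf-IsZero wfφ)) (w-and (wi IsZero vC₁ (wf-IsZero wfφ)) (wi IsZero vC₂ (wf-IsZero wfφ))))
      (wf-exq q (wf-exq q (wf-exq q (w-and w-rvar (w-and (wi IsSucc v-y'y (wf-IsSucc wfφ)) (wf-or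
        (w-and (wi IsSucc v-d₁c₁ (wf-IsSucc wfφ)) (w-and (wi Less v-c₁m (wf-Less wfφ)) (wi Equal v-d₂c₂ (wf-Equal wfφ))))
        (w-and (wi IsZero (under3 vC₁) (wf-IsZero wfφ)) (w-and (wi IsSucc v-d₁m (wf-IsSucc wfφ)) (wf-or
          (w-and (wi IsSucc v-d₂c₂ (wf-IsSucc wfφ)) (wi Less v-c₂t (wf-Less wfφ)))
          (w-and (wi IsZero (under3 vC₂) (wf-IsZero wfφ)) (wi IsSucc v-d₂t (wf-IsSucc wfφ))))))))))))

  -- Digit with the roles of the variables swapped: x = (m, t, r), y = y.
  v-swap : Vec (Fin ((q + (q + q)) + q)) D
  v-swap = under (q + (q + q)) (allFin q) ++ front q (allFin (q + (q + q)))

  DigitSwapped : Formula σ ((q + (q + q)) + q) []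
  DigitSwapped = inst Digit v-swap

  wf-DigitSwapped : WF φ → WF DigitSwapped
  wf-DigitSwapped wfφ = wf-inst Digit v-swap (wf-Digit wfφ)

module CounterSemantics {σ : Signature} (p q : ℕ) (φ : Formula σ (p + q) [])
                        (M : Structure σ) (two≤size : 2 ≤ size M) where
  open OrderSemantics p q φ M two≤size public
  open DigitCounter p q φ public

  module CounterBodySemantics (m t : Tup) (ρ₁ : Vec S outerC) (hm : ⟦ mC ⟧ ρ₁ ≡ m) (ht : ⟦ tC ⟧ ρ₁ ≡ t)
                              (X : Vec S Kc → Bool) (Y C₁ C₂ : Tup) (Z : Vec S P) where
    args : Vec S Kc
    args = Y ++ (C₁ ++ (C₂ ++ Z))

    ρW : Vec S W
    ρW = args ++ ρ₁

    E : Env (Kc ∷ []) s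
    E = envCons {[]} {s} {Kc} X e₀

    ⟦vY⟧ : ⟦ vY ⟧ ρW ≡ Y
    ⟦vY⟧ = trans (⟦front⟧ args ρ₁ (first q)) (⟦first⟧ Y (C₁ ++ (C₂ ++ Z)))

    ⟦vC₁⟧ : ⟦ vC₁ ⟧ ρW ≡ C₁
    ⟦vC₁⟧ = trans (⟦front⟧ args ρ₁ _) (trans (⟦under⟧ Y (C₁ ++ (C₂ ++ Z)) (first q)) (⟦first⟧ C₁ (C₂ ++ Z)))

    ⟦vC₂⟧ : ⟦ vC₂ ⟧ ρW ≡ C₂
    ⟦vC₂⟧ = trans (⟦front⟧ args ρ₁ _) (trans (⟦under⟧ Y (C₁ ++ (C₂ ++ Z)) (under q (first q)))
              (trans (⟦under⟧ C₁ (C₂ ++ Z) (first q)) (⟦first⟧ C₂ Z)))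

    ⟦vZ⟧ : ⟦ vZ ⟧ ρW ≡ Z
    ⟦vZ⟧ = trans (⟦front⟧ args ρ₁ _) (trans (⟦under⟧ Y (C₁ ++ (C₂ ++ Z)) (under q (under q (allFin P))))
              (trans (⟦under⟧ C₁ (C₂ ++ Z) (under q (allFin P))) (trans (⟦under⟧ C₂ Z (allFin P)) (⟦all⟧ Z))))

    ⟦vM⟧ : ⟦ vM ⟧ ρW ≡ m
    ⟦vM⟧ = trans (⟦under⟧ args ρ₁ mC) hm

    ⟦vT⟧ : ⟦ vT ⟧ ρW ≡ t
    ⟦vT⟧ = trans (⟦under⟧ args ρ₁ tC) ht

    -- The inductive case with predecessor (a, b, c) = (y', d₁, d₂).
    module StepSemantics (a b c : Tup) where
      ρ₃ : Vec S Wstep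
      ρ₃ = a ++ (b ++ (c ++ ρW))

      ⟦under3⟧ : ∀ {j} (v : Vec (Fin W) j) {w} → ⟦ v ⟧ ρW ≡ w → ⟦ under3 v ⟧ ρ₃ ≡ w
      ⟦under3⟧ v e = trans (⟦under⟧ a (b ++ (c ++ ρW)) (under q (under q v)))
                       (trans (⟦under⟧ b (c ++ ρW) (under q v)) (trans (⟦under⟧ c ρW v) e))

      ⟦vY'⟧ : ⟦ vY' ⟧ ρ₃ ≡ a
      ⟦vY'⟧ = ⟦first⟧ a (b ++ (c ++ ρW))

      ⟦vD₁⟧ : ⟦ vD₁ ⟧ ρ₃ ≡ b
      ⟦vD₁⟧ = trans (⟦under⟧ a (b ++ (c ++ ρW)) (first q)) (⟦first⟧ b (c ++ ρW))

      ⟦vD₂⟧ : ⟦ vD₂ ⟧ ρ₃ ≡ c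
      ⟦vD₂⟧ = trans (⟦under⟧ a (b ++ (c ++ ρW)) (under q (first q))) (trans (⟦under⟧ b (c ++ ρW) (first q)) (⟦first⟧ c ρW))

      ⟦v-d₁c₁⟧ : ⟦ v-d₁c₁ ⟧ ρ₃ ≡ b ++ C₁
      ⟦v-d₁c₁⟧ = ⟦++⟧ vD₁ (under3 vC₁) ρ₃ ⟦vD₁⟧ (⟦under3⟧ vC₁ ⟦vC₁⟧)

      ⟦v-c₁m⟧ : ⟦ v-c₁m ⟧ ρ₃ ≡ C₁ ++ m
      ⟦v-c₁m⟧ = ⟦++⟧ (under3 vC₁) (under3 vM) ρ₃ (⟦under3⟧ vC₁ ⟦vC₁⟧) (⟦under3⟧ vM ⟦vM⟧)

      ⟦v-d₂c₂⟧ : ⟦ v-d₂c₂ ⟧ ρ₃ ≡ c ++ C₂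
      ⟦v-d₂c₂⟧ = ⟦++⟧ vD₂ (under3 vC₂) ρ₃ ⟦vD₂⟧ (⟦under3⟧ vC₂ ⟦vC₂⟧)

      ⟦v-d₁m⟧ : ⟦ v-d₁m ⟧ ρ₃ ≡ b ++ m
      ⟦v-d₁m⟧ = ⟦++⟧ vD₁ (under3 vM) ρ₃ ⟦vD₁⟧ (⟦under3⟧ vM ⟦vM⟧)

      ⟦v-c₂t⟧ : ⟦ v-c₂t ⟧ ρ₃ ≡ C₂ ++ t
      ⟦v-c₂t⟧ = ⟦++⟧ (under3 vC₂) (under3 vT) ρ₃ (⟦under3⟧ vC₂ ⟦vC₂⟧) (⟦under3⟧ vT ⟦vT⟧)

      ⟦v-d₂t⟧ : ⟦ v-d₂t ⟧ ρ₃ ≡ c ++ t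
      ⟦v-d₂t⟧ = ⟦++⟧ vD₂ (under3 vT) ρ₃ ⟦vD₂⟧ (⟦under3⟧ vT ⟦vT⟧)

      ⟦v-y'y⟧ : ⟦ v-y'y ⟧ ρ₃ ≡ a ++ Y
      ⟦v-y'y⟧ = ⟦++⟧ vY' (under3 vY) ρ₃ ⟦vY'⟧ (⟦under3⟧ vY ⟦vY⟧)

      ⟦v-rec⟧ : ⟦ v-rec ⟧ ρ₃ ≡ a ++ (b ++ (c ++ Z))
      ⟦v-rec⟧ = ⟦++⟧ vY' _ ρ₃ ⟦vY'⟧ (⟦++⟧ vD₁ _ ρ₃ ⟦vD₁⟧ (⟦++⟧ vD₂ _ ρ₃ ⟦vD₂⟧ (⟦under3⟧ vZ ⟦vZ⟧)))

      get : ∀ {n} (ψ : Formula σ n []) (vs : Vec (Fin Wstep) n) {w} → ⟦ vs ⟧ ρ₃ ≡ w →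
            T (eval M (inst ψ vs) ρ₃ E) → T (ev ψ w)
      get ψ vs e = T-to (inst-val (Kc ∷ []) ψ vs ρ₃ E e)

      put : ∀ {n} (ψ : Formula σ n []) (vs : Vec (Fin Wstep) n) {w} → ⟦ vs ⟧ ρ₃ ≡ w →
            T (ev ψ w) → T (eval M (inst ψ vs) ρ₃ E)
      put ψ vs e = T-from (inst-val (Kc ∷ []) ψ vs ρ₃ E e)

      StepR : Set
      StepR = Step (height b) (height c) (height C₁) (height C₂) (height m) (height t)

      HighR : Set
      HighR = (height C₂ ≡ suc (height c) × height C₂ < height t) ⊎ (height C₂ ≡ 0 × height t ≡ suc (height c))

      ev₃ : Formula σ Wstep (Kc ∷ []) → Bool
      ev₃ ψ = eval M ψ ρ₃ E

      High-sem : Iff (T (ev₃ (or HighUp HighWrap))) HighR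
      High-sem = to , from
        where
        to : T (ev₃ (or HighUp HighWrap)) → HighR
        to h = by-case (or-elim (Kc ∷ []) HighUp HighWrap ρ₃ E h)
          where
          by-case : T (ev₃ HighUp) ⊎ T (ev₃ HighWrap) → HighR
          by-case (inj₁ v) = let (v₁ , v₂) = T∧-elim {ev₃ (inst IsSucc v-d₂c₂)} v in
            inj₁ (proj₁ (IsSucc-sem c C₂) (get IsSucc v-d₂c₂ ⟦v-d₂c₂⟧ v₁) , proj₁ (Less-sem C₂ t) (get Less v-c₂t ⟦v-c₂t⟧ v₂))
          by-case (inj₂ v) = let (v₁ , v₂) = T∧-elim {ev₃ (inst IsZero (under3 vC₂))} v in
            inj₂ (proj₁ (IsZero-sem C₂) (get IsZero (under3 vC₂) (⟦under3⟧ vC₂ ⟦vC₂⟧) v₁) ,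
                  proj₁ (IsSucc-sem c t) (get IsSucc v-d₂t ⟦v-d₂t⟧ v₂))
        from : HighR → T (ev₃ (or HighUp HighWrap))
        from (inj₁ (v₁ , v₂)) = or-introˡ (Kc ∷ []) HighUp HighWrap ρ₃ E
          (T∧-intro {ev₃ (inst IsSucc v-d₂c₂)} (put IsSucc v-d₂c₂ ⟦v-d₂c₂⟧ (proj₂ (IsSucc-sem c C₂) v₁))
                                               (put Less v-c₂t ⟦v-c₂t⟧ (proj₂ (Less-sem C₂ t) v₂)))
        from (inj₂ (v₁ , v₂)) = or-introʳ (Kc ∷ []) HighUp HighWrap ρ₃ E
          (T∧-intro {ev₃ (inst IsZero (under3 vC₂))}
            (put IsZero (under3 vC₂) (⟦under3⟧ vC₂ ⟦vC₂⟧) (proj₂ (IsZero-sem C₂) v₁))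
            (put IsSucc v-d₂t ⟦v-d₂t⟧ (proj₂ (IsSucc-sem c t) v₂)))

      StepF-sem : Iff (T (ev₃ StepF)) StepR
      StepF-sem = to , from
        where
        Wrap : Formula σ Wstep (Kc ∷ [])
        Wrap = and (inst IsZero (under3 vC₁)) (and (inst IsSucc v-d₁m) (or HighUp HighWrap))
        to : T (ev₃ StepF) → StepR
        to h = by-case (or-elim (Kc ∷ []) LowUp Wrap ρ₃ E h)
          where
          by-case : T (ev₃ LowUp) ⊎ T (ev₃ Wrap) → StepR
          by-case (inj₁ h₁) =
            let (u₁ , u') = T∧-elim {ev₃ (inst IsSucc v-d₁c₁)} h₁
                (u₂ , u₃) = T∧-elim {ev₃ (inst Less v-c₁m)} u'
            in inj₁ (proj₁ (IsSucc-sem b C₁) (get IsSucc v-d₁c₁ ⟦v-d₁c₁⟧ u₁) ,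
                     proj₁ (Less-sem C₁ m) (get Less v-c₁m ⟦v-c₁m⟧ u₂) ,
                     proj₁ (Equal-sem c C₂) (get Equal v-d₂c₂ ⟦v-d₂c₂⟧ u₃))
          by-case (inj₂ h₂) =
            let (u₁ , u') = T∧-elim {ev₃ (inst IsZero (under3 vC₁))} h₂
                (u₂ , u₃) = T∧-elim {ev₃ (inst IsSucc v-d₁m)} u'
            in inj₂ (proj₁ (IsZero-sem C₁) (get IsZero (under3 vC₁) (⟦under3⟧ vC₁ ⟦vC₁⟧) u₁) ,
                     proj₁ (IsSucc-sem b m) (get IsSucc v-d₁m ⟦v-d₁m⟧ u₂) ,
                     proj₁ High-sem u₃)
        from : StepR → T (ev₃ StepF)
        from (inj₁ (x₁ , x₂ , x₃)) = or-introˡ (Kc ∷ []) LowUp Wrap ρ₃ E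
          (T∧-intro {ev₃ (inst IsSucc v-d₁c₁)} (put IsSucc v-d₁c₁ ⟦v-d₁c₁⟧ (proj₂ (IsSucc-sem b C₁) x₁))
            (T∧-intro {ev₃ (inst Less v-c₁m)} (put Less v-c₁m ⟦v-c₁m⟧ (proj₂ (Less-sem C₁ m) x₂))
                                               (put Equal v-d₂c₂ ⟦v-d₂c₂⟧ (proj₂ (Equal-sem c C₂) x₃))))
        from (inj₂ (x₁ , x₂ , x₃)) = or-introʳ (Kc ∷ []) LowUp Wrap ρ₃ E
          (T∧-intro {ev₃ (inst IsZero (under3 vC₁))} (put IsZero (under3 vC₁) (⟦under3⟧ vC₁ ⟦vC₁⟧) (proj₂ (IsZero-sem C₁) x₁))
            (T∧-intro {ev₃ (inst IsSucc v-d₁m)} (put IsSucc v-d₁m ⟦v-d₁m⟧ (proj₂ (IsSucc-sem b m) x₂))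
                                                 (proj₂ High-sem x₃)))

      InductiveR : Set
      InductiveR = T (X (a ++ (b ++ (c ++ Z)))) × height Y ≡ suc (height a) × StepR

      Inductive-sem : Iff (T (ev₃ Inductive)) InductiveR
      Inductive-sem = to , from
        where
        to : T (ev₃ Inductive) → InductiveR
        to h = let (hx , h') = T∧-elim {ev₃ (rvar zero v-rec)} h
                   (hs , hb) = T∧-elim {ev₃ (inst IsSucc v-y'y)} h'
               in T-to (cong X ⟦v-rec⟧) hx , proj₁ (IsSucc-sem a Y) (get IsSucc v-y'y ⟦v-y'y⟧ hs) , proj₁ StepF-sem hb
        from : InductiveR → T (ev₃ Inductive)
        from (hx , sY , st) = T∧-intro {ev₃ (rvar zero v-rec)} (T-from (cong X ⟦v-rec⟧) hx)
          (T∧-intro {ev₃ (inst IsSucc v-y'y)} (put IsSucc v-y'y ⟦v-y'y⟧ (proj₂ (IsSucc-sem a Y) sY)) (proj₂ StepF-sem st))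

    open StepSemantics using (InductiveR; Inductive-sem)

    BodyR : Set
    BodyR = (height Y ≡ 0 × height C₁ ≡ 0 × height C₂ ≡ 0) ⊎ (∃ λ a → ∃ λ b → ∃ λ c → InductiveR a b c)

    Base-val : ∀ {v : Vec (Fin W) q} {w} → ⟦ v ⟧ ρW ≡ w → eval M (inst IsZero v) ρW E ≡ ev IsZero w
    Base-val {v} e = inst-val (Kc ∷ []) IsZero v ρW E e

    Step∃ : Formula σ W (Kc ∷ [])
    Step∃ = exq q (exq q (exq q Inductive))

    body-sem : Iff (T (eval M CounterBody ρW E)) BodyR
    body-sem = to , from
      where
      to : T (eval M CounterBody ρW E) → BodyR
      to h = by-case (or-elim (Kc ∷ []) Base Step∃ ρW E h)
        where
        by-case : T (eval M Base ρW E) ⊎ T (eval M Step∃ ρW E) → BodyR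
        by-case (inj₁ hb) =
          let (u₁ , u') = T∧-elim {eval M (inst IsZero vY) ρW E} hb
              (u₂ , u₃) = T∧-elim {eval M (inst IsZero vC₁) ρW E} u'
          in inj₁ (proj₁ (IsZero-sem Y) (T-to (Base-val ⟦vY⟧) u₁) ,
                   proj₁ (IsZero-sem C₁) (T-to (Base-val ⟦vC₁⟧) u₂) ,
                   proj₁ (IsZero-sem C₂) (T-to (Base-val ⟦vC₂⟧) u₃))
        by-case (inj₂ hs) =
          let (t₁ , h₁) = exq-elim (Kc ∷ []) q (exq q (exq q Inductive)) ρW E hs
              (t₂ , h₂) = exq-elim (Kc ∷ []) q (exq q Inductive) (t₁ ++ ρW) E h₁
              (t₃ , h₃) = exq-elim (Kc ∷ []) q Inductive (t₂ ++ (t₁ ++ ρW)) E h₂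
          in inj₂ (t₃ , t₂ , t₁ , proj₁ (Inductive-sem t₃ t₂ t₁) h₃)
      from : BodyR → T (eval M CounterBody ρW E)
      from (inj₁ (z₁ , z₂ , z₃)) = or-introˡ (Kc ∷ []) Base Step∃ ρW E
        (T∧-intro {eval M (inst IsZero vY) ρW E} (T-from (Base-val ⟦vY⟧) (proj₂ (IsZero-sem Y) z₁))
          (T∧-intro {eval M (inst IsZero vC₁) ρW E} (T-from (Base-val ⟦vC₁⟧) (proj₂ (IsZero-sem C₁) z₂))
                                                     (T-from (Base-val ⟦vC₂⟧) (proj₂ (IsZero-sem C₂) z₃))))
      from (inj₂ (a , b , c , r)) = or-introʳ (Kc ∷ []) Base Step∃ ρW E
        (exq-intro (Kc ∷ []) q (exq q (exq q Inductive)) ρW E c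
          (exq-intro (Kc ∷ []) q (exq q Inductive) (c ++ ρW) E b
            (exq-intro (Kc ∷ []) q Inductive (b ++ (c ++ ρW)) E a (proj₂ (Inductive-sem a b c) r))))

module DigitSemantics {σ : Signature} (p q : ℕ) (φ : Formula σ (p + q) [])
                      (M : Structure σ) (two≤size : 2 ≤ size M) where
  open CounterSemantics p q φ M two≤size public

  P≤Kc : P ≤ Kc
  P≤Kc = subst (P ≤_) (trans (+-assoc (q + q) q P) (+-assoc q q (q + P))) (m≤n+m P (q + q + q))

  module CounterFixedPoint (m t : Tup) (ρ₁ : Vec S outerC) (hm : ⟦ mC ⟧ ρ₁ ≡ m) (ht : ⟦ tC ⟧ ρ₁ ≡ t)
                           (m>0 : 0 < height m) (t>0 : 0 < height t) where
    open CounterBodySemantics m t ρ₁ hm ht using (body-sem)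

    Counted : Vec S Kc → Set
    Counted u = Digits (height m) (height t) (height (take q u)) (height (take q (drop q u)))
                       (height (take q (drop q (drop q u))))

    rankC : Vec S Kc → ℕ
    rankC u = height (take q u)

    module _ (Y C₁ C₂ : Tup) (Z : Vec S P) where
      private
        u : Vec S Kc
        u = Y ++ (C₁ ++ (C₂ ++ Z))
        eY : height (take q u) ≡ height Y
        eY = cong height (take-++ Y _)
        eC₁ : height (take q (drop q u)) ≡ height C₁
        eC₁ = cong height (take-drop-++ Y C₁ (C₂ ++ Z))
        eC₂ : height (take q (drop q (drop q u))) ≡ height C₂
        eC₂ = cong height (trans (cong (λ v → take q (drop q v)) (drop-++ Y (C₁ ++ (C₂ ++ Z)))) (take-drop-++ C₁ C₂ Z))

      Counted-intro : Digits (height m) (height t) (height Y) (height C₁) (height C₂) → Counted u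
      Counted-intro = subst (λ (v : ℕ × ℕ × ℕ) → Digits (height m) (height t) (proj₁ v) (proj₁ (proj₂ v)) (proj₂ (proj₂ v)))
                            (sym (cong₂ _,_ eY (cong₂ _,_ eC₁ eC₂)))

      Counted-elim : Counted u → Digits (height m) (height t) (height Y) (height C₁) (height C₂)
      Counted-elim = subst (λ (v : ℕ × ℕ × ℕ) → Digits (height m) (height t) (proj₁ v) (proj₁ (proj₂ v)) (proj₂ (proj₂ v)))
                           (cong₂ _,_ eY (cong₂ _,_ eC₁ eC₂))

      rankC-++ : rankC u ≡ height Y
      rankC-++ = eY

    Counter-sound : ∀ (X : Vec S Kc → Bool) → (∀ u → T (X u) → Counted u) → ∀ u →
                    T (eval M CounterBody (u ++ ρ₁) (envCons {[]} {s} {Kc} X e₀)) → Counted u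
    Counter-sound X hX u = by-split (split₄ q q q P u)
      where
      by-split : ∀ {u} → Split₄ q q q P u →
                 T (eval M CounterBody (u ++ ρ₁) (envCons {[]} {s} {Kc} X e₀)) → Counted u
      by-split (split₄-as Y C₁ C₂ Z) h = Counted-intro Y C₁ C₂ Z (by-case (proj₁ (body-sem X Y C₁ C₂ Z) h))
        where
        by-case : CounterBodySemantics.BodyR m t ρ₁ hm ht X Y C₁ C₂ Z →
                  Digits (height m) (height t) (height Y) (height C₁) (height C₂)
        by-case (inj₁ (z₁ , z₂ , z₃)) =
          digits-cong (sym z₁) (sym z₂) (sym z₃) (digits-zero (height m) (height t) m>0 t>0)
        by-case (inj₂ (a , b , c , hx , sY , st)) =
          digits-cong (sym sY) refl refl
            (digits-step (height m) (height t) (height a) (height b) (height c) (height C₁) (height C₂)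
               (Counted-elim a b c Z (hX _ hx)) st)

    -- Completeness: by digits-pred, realising the predecessor's digits as
    -- heights of tuples (they lie below heights m, t and y).
    Counter-complete : ∀ u → Counted u → ∀ (X : Vec S Kc → Bool) →
                       (∀ u' → Counted u' → rankC u' < rankC u → T (X u')) →
                       T (eval M CounterBody (u ++ ρ₁) (envCons {[]} {s} {Kc} X e₀))
    Counter-complete u r X hX = by-split (split₄ q q q P u) r hX
      where
      by-split : ∀ {u} → Split₄ q q q P u → Counted u → (∀ u' → Counted u' → rankC u' < rankC u → T (X u')) →
                 T (eval M CounterBody (u ++ ρ₁) (envCons {[]} {s} {Kc} X e₀))
      by-split (split₄-as Y C₁ C₂ Z) r hX =
        proj₂ (body-sem X Y C₁ C₂ Z) (by-case (digits-pred (height m) (height t) _ _ _ (Counted-elim Y C₁ C₂ Z r)))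
        where
        by-case : (height Y ≡ 0 × height C₁ ≡ 0 × height C₂ ≡ 0) ⊎
                  (∃ λ y' → ∃ λ d₁ → ∃ λ d₂ → height Y ≡ suc y' × Digits (height m) (height t) y' d₁ d₂ ×
                     Step d₁ d₂ (height C₁) (height C₂) (height m) (height t)) →
                  CounterBodySemantics.BodyR m t ρ₁ hm ht X Y C₁ C₂ Z
        by-case (inj₁ x) = inj₁ x
        by-case (inj₂ (y' , d₁ , d₂ , ey , ds , st)) =
          let (a , ha) = height-realised Y y' (subst (y' ≤_) (sym ey) (n≤1+n y'))
              (_ , _ , l₁ , l₂) = ds
              (b , hb) = height-realised m d₁ (<⇒≤ l₁)
              (c , hc) = height-realised t d₂ (<⇒≤ l₂)
          in inj₂ (a , b , c , predecessor a b c ha hb hc)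
          where
          predecessor : ∀ a b c → height a ≡ y' → height b ≡ d₁ → height c ≡ d₂ →
                        CounterBodySemantics.StepSemantics.InductiveR m t ρ₁ hm ht X Y C₁ C₂ Z a b c
          predecessor a b c refl refl refl =
            hX _ (Counted-intro a b c Z ds)
               (subst₂ _<_ (sym (rankC-++ a b c Z)) (sym (rankC-++ Y C₁ C₂ Z)) (subst (height a <_) (sym ey) ≤-refl)) ,
            ey , st

    counter-char : ∀ u → Iff (T (stage M Kc CounterBody ρ₁ e₀ (s ^ Kc) u)) (Counted u)
    counter-char = LFPCharacterisation.lfp-char M Kc CounterBody ρ₁ e₀ Counted rankC Counter-sound Counter-complete
                     (λ u _ → height<s^ Kc P≤Kc (take q u))

  module DigitScope (y m t r : Tup) (m>0 : 0 < height m) (t>0 : 0 < height t) where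
    ρD : Vec S D
    ρD = y ++ (m ++ (t ++ r))

    module Witnessed (c₁ c₂ : Tup) (z : Vec S P) where
      ρ₂ : Vec S (q + (q + D))
      ρ₂ = c₁ ++ (c₂ ++ ρD)

      ρ₁ : Vec S outerC
      ρ₁ = z ++ ρ₂

      hm : ⟦ mC ⟧ ρ₁ ≡ m
      hm = trans (⟦under⟧ z ρ₂ _) (trans (⟦under⟧ c₁ (c₂ ++ ρD) _)
             (trans (⟦under⟧ c₂ ρD _) (trans (⟦under⟧ y (m ++ (t ++ r)) (first q)) (⟦first⟧ m (t ++ r)))))

      ht : ⟦ tC ⟧ ρ₁ ≡ t
      ht = trans (⟦under⟧ z ρ₂ _) (trans (⟦under⟧ c₁ (c₂ ++ ρD) _)
             (trans (⟦under⟧ c₂ ρD _) (trans (⟦under⟧ y (m ++ (t ++ r)) (under q (first q)))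
               (trans (⟦under⟧ m (t ++ r) (first q)) (⟦first⟧ t r)))))

      ⟦CounterArgs⟧ : ⟦ CounterArgs ⟧ ρ₁ ≡ y ++ (c₁ ++ (c₂ ++ z))
      ⟦CounterArgs⟧ = ⟦++⟧ (under P (under q (under q (first q)))) _ ρ₁
        (trans (⟦under⟧ z ρ₂ _) (trans (⟦under⟧ c₁ (c₂ ++ ρD) _) (trans (⟦under⟧ c₂ ρD (first q)) (⟦first⟧ y (m ++ (t ++ r))))))
        (⟦++⟧ (under P (first q)) _ ρ₁ (trans (⟦under⟧ z ρ₂ (first q)) (⟦first⟧ c₁ (c₂ ++ ρD)))
          (⟦++⟧ (under P (under q (first q))) (first P) ρ₁
            (trans (⟦under⟧ z ρ₂ _) (trans (⟦under⟧ c₁ (c₂ ++ ρD) (first q)) (⟦first⟧ c₂ ρD)))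
            (⟦first⟧ z ρ₂)))

      ⟦v-c₂r⟧ : ⟦ v-c₂r ⟧ ρ₂ ≡ c₂ ++ r
      ⟦v-c₂r⟧ = ⟦++⟧ (under q (first q)) _ ρ₂ (trans (⟦under⟧ c₁ (c₂ ++ ρD) (first q)) (⟦first⟧ c₂ ρD))
        (trans (⟦under⟧ c₁ (c₂ ++ ρD) _) (trans (⟦under⟧ c₂ ρD _) (trans (⟦under⟧ y (m ++ (t ++ r)) _)
          (trans (⟦under⟧ m (t ++ r) _) (trans (⟦under⟧ t r (allFin q)) (⟦all⟧ r))))))

      counter : Iff (T (stage M Kc CounterBody ρ₁ e₀ (s ^ Kc) (⟦ CounterArgs ⟧ ρ₁)))
                    (Digits (height m) (height t) (height y) (height c₁) (height c₂))
      counter = let open CounterFixedPoint m t ρ₁ hm ht m>0 t>0 in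
        (λ h → Counted-elim y c₁ c₂ z (proj₁ (counter-char _) (T-to at-args h))) ,
        (λ d → T-from at-args (proj₂ (counter-char _) (Counted-intro y c₁ c₂ z d)))
        where
        at-args : stage M Kc CounterBody ρ₁ e₀ (s ^ Kc) (⟦ CounterArgs ⟧ ρ₁)
                ≡ stage M Kc CounterBody ρ₁ e₀ (s ^ Kc) (y ++ (c₁ ++ (c₂ ++ z)))
        at-args = cong (stage M Kc CounterBody ρ₁ e₀ (s ^ Kc)) ⟦CounterArgs⟧

      Equal-c₂r : Iff (T (eval M (inst Equal v-c₂r) ρ₂ e₀)) (height c₂ ≡ height r)
      Equal-c₂r = (λ h → proj₁ (Equal-sem c₂ r) (T-to as-ev h)) , (λ e → T-from as-ev (proj₂ (Equal-sem c₂ r) e))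
        where
        as-ev : eval M (inst Equal v-c₂r) ρ₂ e₀ ≡ ev Equal (c₂ ++ r)
        as-ev = inst-val [] Equal v-c₂r ρ₂ e₀ ⟦v-c₂r⟧

    Digit-sound : T (ev Digit ρD) → ∃ λ c → Digits (height m) (height t) (height y) c (height r)
    Digit-sound h =
      let (c₂ , h₁) = exq-elim [] q (exq q DigitMatrix) ρD e₀ h
          (c₁ , h₂) = exq-elim [] q DigitMatrix (c₂ ++ ρD) e₀ h₁
          (ha , hb) = T∧-elim {eval M Counter∃ (c₁ ++ (c₂ ++ ρD)) e₀} h₂
          (z , hz) = exq-elim [] P (lfp Kc CounterBody CounterArgs) (c₁ ++ (c₂ ++ ρD)) e₀ ha
          open Witnessed c₁ c₂ z
      in height c₁ , subst (Digits (height m) (height t) (height y) (height c₁)) (proj₁ Equal-c₂r hb) (proj₁ counter hz)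

    -- For completeness take c₂ := r, c₁ a tuple of the right height, z arbitrary.
    Digit-complete : (∃ λ c → Digits (height m) (height t) (height y) c (height r)) → T (ev Digit ρD)
    Digit-complete (c , ds) =
      let (c₁ , hc₁) = height-realised m c (<⇒≤ (proj₁ (proj₂ (proj₂ ds))))
          z = replicate P elem
          open Witnessed c₁ r z
          hz = proj₂ counter (subst (λ v → Digits (height m) (height t) (height y) v (height r)) (sym hc₁) ds)
      in exq-intro [] q (exq q DigitMatrix) ρD e₀ r
           (exq-intro [] q DigitMatrix (r ++ ρD) e₀ c₁
             (T∧-intro {eval M Counter∃ (c₁ ++ (r ++ ρD)) e₀}
               (exq-intro [] P (lfp Kc CounterBody CounterArgs) (c₁ ++ (r ++ ρD)) e₀ z hz)
               (proj₂ Equal-c₂r refl)))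

  Digit-sem : ∀ (y m t r : Tup) → 0 < height m → 0 < height t →
              Iff (T (ev Digit (y ++ (m ++ (t ++ r))))) (∃ λ c → Digits (height m) (height t) (height y) c (height r))
  Digit-sem y m t r m>0 t>0 = DigitScope.Digit-sound y m t r m>0 t>0 , DigitScope.Digit-complete y m t r m>0 t>0

distinct⇒2≤size : ∀ {s q} (b b' : Vec (Fin s) q) → b ≢ b' → 2 ≤ s
distinct⇒2≤size []      []        ne = ⊥-elim (ne refl)
distinct⇒2≤size (x ∷ b) (x' ∷ b') ne with x Fin.≟ x'
... | yes refl = distinct⇒2≤size b b' (λ e → ne (cong (x ∷_) e))
... | no  x≢x' = two x x' x≢x'
  where
  two : ∀ {s} (x x' : Fin s) → x ≢ x' → 2 ≤ s
  two {suc zero}    zero zero n = ⊥-elim (n refl)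
  two {suc (suc s)} _    _    _ = s≤s (s≤s z≤n)

module SOPChains {σ : Signature} (p q : ℕ) (φ : Formula σ (p + q) []) (M : Structure σ) where
  open StrictInclusion p q φ
  open Heights M

  strict⇒sub : ∀ c b → StrictSub φ M c b → T (sub c b)
  strict⇒sub c b (f , (a , n , y)) = proj₂ (Sub-sem c b)
    ((λ a' h → T-to (env₀ φ (a' ++ b) (λ ())) (f a' (T-from (env₀ φ (a' ++ c) (λ ())) h))) ,
     a , (λ h → n (T-from (env₀ φ (a ++ c) (λ ())) h)) , T-to (env₀ φ (a ++ b) (λ ())) y)

  chain-height : ∀ b rest → Linked (StrictSub φ M) (b ∷ rest) → ∃ λ e → height b + length rest ≤ height e
  chain-height b []          [-]     = b , ≤-reflexive (+-identityʳ _)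
  chain-height b (b' ∷ rest) (r ∷ l) =
    let (e , le) = chain-height b' rest l in
    e , ≤-trans (≤-reflexive (+-suc (height b) (length rest)))
                (≤-trans (+-monoˡ-≤ (length rest) (height-sub b b' (strict⇒sub b b' r))) le)

  strict⇒distinct : ∀ b b' → StrictSub φ M b b' → b ≢ b'
  strict⇒distinct b b' (_ , (a , n , y)) e = n (subst (λ v → Sat {p = p} {q = q} φ M a v) (sym e) y)

record Tall {σ : Signature} (p q : ℕ) (φ : Formula σ (p + q) []) (M : Structure σ) (V : ℕ) : Set where
  field
    two≤size : 2 ≤ size M
    top      : Vec (Fin (size M)) q
    tall     : V ≤ StrictInclusion.Heights.height p q φ M top

sop⇒tall : ∀ {σ} (p q : ℕ) (φ : Formula σ (p + q) []) (M : Structure σ) V →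
           SOP p q φ M (suc (suc V)) → Tall p q φ M V
sop⇒tall p q φ M V (b₀ ∷ b₁ ∷ rest , len , r ∷ chain) = record
  { two≤size = distinct⇒2≤size b₀ b₁ (strict⇒distinct b₀ b₁ r)
  ; top      = proj₁ top-chain
  ; tall     = ≤-trans (≤-trans (n≤1+n V) (subst (_≤ height b₀ + length (b₁ ∷ rest)) (suc-injective len) (m≤n+m _ _)))
                       (proj₂ top-chain)
  }
  where
  open SOPChains p q φ M
  open StrictInclusion.Heights p q φ M using (height)
  top-chain : ∃ λ e → height b₀ + length (b₁ ∷ rest) ≤ height e
  top-chain = chain-height b₀ (b₁ ∷ rest) (r ∷ chain)

-- With tuples of every height up to V at hand, the
-- Digit formula realises TP2(n) and (with the roles of x and y swapped)
-- IP(n), by choosing heights that are digits in base n resp. 2.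
module Witnesses {σ : Signature} (p q : ℕ) (φ : Formula σ (p + q) []) (M : Structure σ) (V : ℕ)
                 (tallM : Tall p q φ M V) where
  open Tall tallM
  open DigitSemantics p q φ M two≤size

  tuple : (v : ℕ) → v ≤ V → Tup
  tuple v le = proj₁ (height-realised top v (≤-trans le tall))

  height-tuple : ∀ v le → height (tuple v le) ≡ v
  height-tuple v le = proj₂ (height-realised top v (≤-trans le tall))

  Digit-at : ∀ (y m t r : Tup) {hy hm ht hr} → height y ≡ hy → height m ≡ hm → height t ≡ ht → height r ≡ hr →
             0 < hm → 0 < ht → Iff (T (ev Digit (y ++ (m ++ (t ++ r))))) (∃ λ c → Digits hm ht hy c hr)
  Digit-at y m t r refl refl refl refl = Digit-sem y m t r

  Sat⇒ev : ∀ {m n} (ψ : Formula σ (m + n) []) (a : Vec S m) (b : Vec S n) → Sat ψ M a b → T (ev ψ (a ++ b))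
  Sat⇒ev ψ a b = T-to (env₀ ψ (a ++ b) (λ ()))

  ev⇒Sat : ∀ {m n} (ψ : Formula σ (m + n) []) (a : Vec S m) (b : Vec S n) → T (ev ψ (a ++ b)) → Sat ψ M a b
  ev⇒Sat ψ a b = T-from (env₀ ψ (a ++ b) (λ ()))

  -- TP2(N): row i consists of b i j = (Nⁱ, N, j), asking for digit i to be j.
  -- Distinct digits in a row are incompatible; a path f is realised by the
  -- number whose base-N digits are f.
  tp2 : ∀ n → V ≡ n ^ n + n → TP2 q (q + (q + q)) Digit M n
  tp2 zero    _  = (λ ()) , (λ ()) , (λ f → tuple 0 z≤n , (λ ()))
  tp2 (suc n) eV = b , row , path
    where
    N : ℕ
    N = suc n
    N≤V : N ≤ V
    N≤V = subst (N ≤_) (sym eV) (m≤n+m N (N ^ N))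
    Nⁱ≤V : ∀ (i : Fin N) → N ^ toℕ i ≤ V
    Nⁱ≤V i = subst (N ^ toℕ i ≤_) (sym eV) (≤-trans (^-monoʳ-≤ N (<⇒≤ (toℕ<n i))) (m≤m+n (N ^ N) N))
    j≤V : ∀ (j : Fin N) → toℕ j ≤ V
    j≤V j = ≤-trans (<⇒≤ (toℕ<n j)) N≤V
    b : Fin N → Fin N → Vec S (q + (q + q))
    b i j = tuple (N ^ toℕ i) (Nⁱ≤V i) ++ (tuple N N≤V ++ tuple (toℕ j) (j≤V j))
    number : (Fin N → Fin N) → ℕ
    number f = value N N (λ j → toℕ (f j))
    number≤V : ∀ f → number f ≤ V
    number≤V f = subst (number f ≤_) (sym eV)
      (≤-trans (<⇒≤ (value-lt N N _ (λ j → toℕ<n (f j)))) (m≤m+n (N ^ N) N))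
    digit : ∀ a i j → Iff (T (ev Digit (a ++ b i j))) (∃ λ c → Digits (N ^ toℕ i) N (height a) c (toℕ j))
    digit a i j = Digit-at a _ _ _ refl (height-tuple _ (Nⁱ≤V i)) (height-tuple N N≤V) (height-tuple _ (j≤V j))
                    (m^n>0 N (toℕ i)) (s≤s z≤n)
    row : (i j k : Fin N) → j ≢ k → (a : Vec S q) → ¬ (Sat Digit M a (b i j) × Sat Digit M a (b i k))
    row i j k j≢k a (h₁ , h₂) =
      let (c , w , e , l₁ , l₂) = proj₁ (digit a i j) (Sat⇒ev Digit a (b i j) h₁)
          (c' , w' , e' , l₁' , l₂') = proj₁ (digit a i k) (Sat⇒ev Digit a (b i k) h₂)
      in j≢k (toℕ-injective (digit-unique (N ^ toℕ i) N c c' (toℕ j) (toℕ k) w w' (trans (sym e) e') l₁ l₁' l₂ l₂'))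
    path : (f : Fin N → Fin N) → Σ (Vec S q) λ a → (i : Fin N) → Sat Digit M a (b i (f i))
    path f = a , λ i →
      let (low , high , e , l) = value-digits N N (λ j → toℕ (f j)) (λ j → toℕ<n (f j)) i
      in ev⇒Sat Digit a (b i (f i))
           (proj₂ (digit a i (f i)) (low , high , trans (height-tuple _ (number≤V f)) e , l , toℕ<n (f i)))
      where
      a = tuple (number f) (number≤V f)

  -- IP(n): aᵢ = (2ⁱ, 2, 1) asks for binary digit i to be 1, and b J is the
  -- number whose binary digits are the indicator of J.
  ⟦v-swap⟧ : ∀ (x : Vec S (q + (q + q))) (y : Tup) → ⟦ v-swap ⟧ (x ++ y) ≡ y ++ x
  ⟦v-swap⟧ x y = ⟦++⟧ (under (q + (q + q)) (allFin q)) (front q (allFin (q + (q + q)))) (x ++ y)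
                   (trans (⟦under⟧ x y (allFin q)) (⟦all⟧ y)) (trans (⟦front⟧ x y (allFin (q + (q + q)))) (⟦all⟧ x))

  indicator : ∀ {n} → Subset n → Fin n → ℕ
  indicator J i = if lookup J i then 1 else 0

  indicator<2 : ∀ {n} (J : Subset n) i → indicator J i < 2
  indicator<2 J i with lookup J i
  ... | true  = s≤s (s≤s z≤n)
  ... | false = s≤s z≤n

  indicator-true : ∀ {n} (J : Subset n) i → 1 ≡ indicator J i → lookup J i ≡ true
  indicator-true J i e with lookup J i
  ... | true  = refl
  ... | false = ⊥-elim (1+n≢0 e)

  indicator-one : ∀ {n} (J : Subset n) i → lookup J i ≡ true → indicator J i ≡ 1
  indicator-one J i e rewrite e = refl

  ip : ∀ n → V ≡ 2 ^ n + 2 → IP (q + (q + q)) q DigitSwapped M n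
  ip n eV = a , b , λ i J → mk⇔ (to i J) (from i J)
    where
    2≤V : 2 ≤ V
    2≤V = subst (2 ≤_) (sym eV) (m≤n+m 2 (2 ^ n))
    1≤V : 1 ≤ V
    1≤V = ≤-trans (s≤s z≤n) 2≤V
    2ⁱ≤V : ∀ (i : Fin n) → 2 ^ toℕ i ≤ V
    2ⁱ≤V i = subst (2 ^ toℕ i ≤_) (sym eV) (≤-trans (^-monoʳ-≤ 2 (<⇒≤ (toℕ<n i))) (m≤m+n (2 ^ n) 2))
    number : Subset n → ℕ
    number J = value 2 n (indicator J)
    number≤V : ∀ J → number J ≤ V
    number≤V J = subst (number J ≤_) (sym eV) (≤-trans (<⇒≤ (value-lt 2 n (indicator J) (indicator<2 J))) (m≤m+n (2 ^ n) 2))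
    a : Fin n → Vec S (q + (q + q))
    a i = tuple (2 ^ toℕ i) (2ⁱ≤V i) ++ (tuple 2 2≤V ++ tuple 1 1≤V)
    b : Subset n → Tup
    b J = tuple (number J) (number≤V J)
    digit : ∀ i J → Iff (T (ev Digit (b J ++ a i))) (∃ λ c → Digits (2 ^ toℕ i) 2 (number J) c 1)
    digit i J = Digit-at (b J) _ _ _ (height-tuple _ (number≤V J)) (height-tuple _ (2ⁱ≤V i))
                  (height-tuple 2 2≤V) (height-tuple 1 1≤V) (m^n>0 2 (toℕ i)) (s≤s z≤n)
    swapped : ∀ i J → eval M DigitSwapped (a i ++ b J) (λ ()) ≡ ev Digit (b J ++ a i)
    swapped i J = inst-val [] Digit v-swap (a i ++ b J) (λ ()) (⟦v-swap⟧ (a i) (b J))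
    to : ∀ i J → Sat DigitSwapped M (a i) (b J) → i ∈ J
    to i J h =
      let (c , w , e' , l₁ , l₂) = proj₁ (digit i J) (T-to (swapped i J) h)
          (low , high , e , l) = value-digits 2 n (indicator J) (indicator<2 J) i
      in lookup⇒[]= i J (indicator-true J i
           (digit-unique (2 ^ toℕ i) 2 c low 1 (indicator J i) w high (trans (sym e') e) l₁ l l₂ (indicator<2 J i)))
    from : ∀ i J → i ∈ J → Sat DigitSwapped M (a i) (b J)
    from i J i∈J =
      let (low , high , e , l) = value-digits 2 n (indicator J) (indicator<2 J) i
          e₁ = trans e (cong (λ d → low + 2 ^ toℕ i * (d + 2 * high)) (indicator-one J i ([]=⇒lookup i∈J)))
      in T-from (swapped i J) (proj₂ (digit i J) (low , high , e₁ , l , s≤s (s≤s z≤n)))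

tall-structures : ∀ {σ} (C : Structure σ → Set) (p q : ℕ) (φ : Formula σ (p + q) []) →
  ((n : ℕ) → Σ (Structure σ) λ M → C M × SOP p q φ M n) →
  ∀ V → Σ (Structure σ) λ M → C M × Tall p q φ M V
tall-structures C p q φ sop V =
  let (M , CM , sopM) = sop (suc (suc V)) in M , CM , sop⇒tall p q φ M V sopM

lemma2p10 : (σ : Signature) (C : Structure σ → Set) →
    HasLFP SOP C → HasLFP IP C × HasLFP TP2 C
lemma2p10 σ C (p , q , φ , wfφ , sop) =
  (q + (q + q) , q , DigitSwapped , wf-DigitSwapped wfφ , ip-witness) ,
  (q , q + (q + q) , Digit , wf-Digit wfφ , tp2-witness)
  where
  open DigitCounter p q φ using (Digit; DigitSwapped; wf-Digit; wf-DigitSwapped)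

  ip-witness : (n : ℕ) → Σ (Structure σ) λ M → C M × IP (q + (q + q)) q DigitSwapped M n
  ip-witness n = let (M , CM , tallM) = tall-structures C p q φ sop (2 ^ n + 2) in
    M , CM , Witnesses.ip p q φ M _ tallM n refl

  tp2-witness : (n : ℕ) → Σ (Structure σ) λ M → C M × TP2 q (q + (q + q)) Digit M n
  tp2-witness n = let (M , CM , tallM) = tall-structures C p q φ sop (n ^ n + n) in
    M , CM , Witnesses.tp2 p q φ M _ tallM n refl
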